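{- Let $n\in\mathbb{N}=\{1,2,\dots\}$ and $m\geq 3$. Then \[ p'_{e,m}(n) -p'_{o,m}(n) = \begin{cases} (-1)^k, & n=P_{m+2,k}\text{ or }n=Q_{m+2,k}\text{ for some }k\in\mathbb{N}; \\ 0, & \text{otherwise,} \end{cases} \] where $P_{g,k}=\frac{k((g-2)k-(g-4))}{2}$ and $Q_{g,k}=\frac{k((g-2)k+(g-4))}{2}$.
   Context: $p'_{e,m}(n)$ (resp. $p'_{o,m}(n)$) is the number of partitions of $n$ into an even (resp. odd) number of distinct parts, each part congruent to $0$, $1$ or $m-1$ modulo $m$. -}

module Defs where

open import Data.Nat using (ℕ; zero; suc; _+_; _*_; _∸_; _%_; _/_; _≡ᵇ_; NonZero)
open import Data.Bool using (Bool; true; false; _∨_; _∧_; if_then_else_)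
open import Data.List using (List; []; _∷_; length; filter; map; _++_)
open import Data.Nat.ListAction using (sum)
open import Data.Integer using (ℤ; +_; -[1+_]) renaming (_-_ to _-ℤ_)
open import Relation.Binary.PropositionalEquality using (_≡_)
open import Relation.Nullary.Decidable using (Dec; yes; no)
open import Data.Bool using (T)
open import Relation.Nullary.Decidable using (does)
open import Data.Bool.Properties using (T?)

sublists : List ℕ → List (List ℕ)
sublists [] = [] ∷ []
sublists (x ∷ xs) = map (x ∷_) (sublists xs) ++ sublists xs

down : ℕ → List ℕ
down zero = []
down (suc n) = suc n ∷ down n

allowedᵇ : (m : ℕ) → .{{NonZero m}} → ℕ → Bool
allowedᵇ m p = ((p % m) ≡ᵇ 0) ∨ ((p % m) ≡ᵇ 1) ∨ ((p % m) ≡ᵇ (m ∸ 1))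

allAllowedᵇ : (m : ℕ) → .{{NonZero m}} → List ℕ → Bool
allAllowedᵇ m [] = true
allAllowedᵇ m (p ∷ ps) = allowedᵇ m p ∧ allAllowedᵇ m ps

evenᵇ : ℕ → Bool
evenᵇ zero = true
evenᵇ (suc zero) = false
evenᵇ (suc (suc k)) = evenᵇ k

-- Partitions of n into distinct parts, each ≡ 0, 1 or m-1 (mod m):
-- exactly the subsets of {1,...,n} (as strictly decreasing lists) of
-- allowed elements summing to n.
partitions' : (m : ℕ) → .{{NonZero m}} → ℕ → List (List ℕ)
partitions' m n = filter (λ ps → T? (allAllowedᵇ m ps ∧ (sum ps ≡ᵇ n))) (sublists (down n))

p'e : (m : ℕ) → .{{NonZero m}} → ℕ → ℕ
p'e m n = length (filter (λ ps → T? (evenᵇ (length ps))) (partitions' m n))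

p'o : (m : ℕ) → .{{NonZero m}} → ℕ → ℕ
p'o m n = length (filter (λ ps → T? (if evenᵇ (length ps) then false else true)) (partitions' m n))

sgn : ℕ → ℤ
sgn k = if evenᵇ k then + 1 else -[1+ 0 ]

-- P_{g,k} = k((g-2)k-(g-4))/2 and Q_{g,k} = k((g-2)k+(g-4))/2, for g = m+2, i.e.
-- P = k(mk-(m-2))/2, Q = k(mk+(m-2))/2 (exact divisions; mk ≥ m-2 for k ≥ 1).
P : ℕ → ℕ → ℕ
P m k = (k * (m * k ∸ (m ∸ 2))) / 2

Q : ℕ → ℕ → ℕ
Q m k = (k * (m * k + (m ∸ 2))) / 2

diff : (m : ℕ) → .{{NonZero m}} → ℕ → ℤ
diff m n = (+ p'e m n) -ℤ (+ p'o m n)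

-- The signed count p′_e(n) − p′_o(n) is the coefficient of xⁿ in ∏ (1 − x^p) over the allowed
-- parts p.  With q = x^m these factors are (1 − q^(j+1)) (1 − x q^j) (1 − x^(m−1) q^j) for j ≥ 0,
-- and Jacobi's triple product turns the product into Σ_{k ∈ ℤ} (−1)^k x^(e k), where e k = P_{m+2,k}
-- for k ≥ 0 and e k = Q_{m+2,−k} for k < 0.  To stay with finite objects we prove, by induction
-- on a and b, the finite triple product
--   ∏_{j<a} (1 − x q^j) ∏_{j<b} (1 − x^(m−1) q^j) = Σ_{r+s=a+b} (−1)^(r−b) x^(e (r−b)) [r+s, r]_q.
-- The allowed parts up to m T give (q; q)_T times its left-hand side for a = b = T, and
-- (q; q)_T [r+s, r]_q ≡ 1 below degree m (1 + min(r, s, T)).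
-- For T = 2n + 1 every term with e (r − T) ≤ n has r, s > n, so the coefficient of xⁿ is the sum
-- of (−1)^k over the k with e k = n; for m ≥ 3 the exponents e k are pairwise distinct.

module Submission where

open import Defs
open import Data.Nat using (ℕ; _≤_; NonZero)
open import Data.Integer using (ℤ; +_)
open import Data.Product using (_×_)
open import Data.Sum using (_⊎_)
open import Relation.Binary.PropositionalEquality using (_≡_; _≢_)
open import Data.Nat using (suc; _<_; s≤s; z≤n)
open import Data.Product using (_,_; proj₁; proj₂)
open import Data.Sum using (inj₁; inj₂)
open import Relation.Binary.PropositionalEquality using (sym; trans)

module BooleanEquality where

  open import Data.Nat using (_≡ᵇ_)
  import Data.Nat.Properties as ℕ
  open import Data.Bool using (true; false)
  open import Data.Bool.Properties using (T-≡; ¬-not)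
  open import Function.Bundles using (Equivalence)
  open import Relation.Binary.PropositionalEquality

  ≡ᵇ-refl : ∀ n → (n ≡ᵇ n) ≡ true
  ≡ᵇ-refl n = Equivalence.to T-≡ (ℕ.≡⇒≡ᵇ n n refl)

  ≢⇒≡ᵇ-false : ∀ a b → a ≢ b → (a ≡ᵇ b) ≡ false
  ≢⇒≡ᵇ-false a b a≢b = ¬-not (λ a≡ᵇb → a≢b (ℕ.≡ᵇ⇒≡ a b (Equivalence.from T-≡ a≡ᵇb)))

module PowerSeries where

  open BooleanEquality
  open import Data.Nat as ℕ using (zero; suc; _<_; s≤s)
  open import Data.Bool using (true; false; if_then_else_)
  import Data.Nat.Properties as ℕ
  open import Data.Integer using (-_; _+_; _-_; _*_)
  import Data.Integer.Properties as ℤ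
  open import Data.Integer.Tactic.RingSolver using (solve-∀)
  open import Data.List using (List; []; _∷_; _++_)
  open import Data.List.Relation.Unary.All using (All; []; _∷_)
  open import Relation.Binary.PropositionalEquality
  open import Relation.Binary.Bundles using (Setoid)
  import Relation.Binary.Reasoning.Setoid as SetoidReasoning

  Series : Set
  Series = ℕ → ℤ

  module ≗-Reasoning = SetoidReasoning (ℕ →-setoid ℤ)
  open Setoid (ℕ →-setoid ℤ) public using () renaming (sym to ≗-sym; trans to ≗-trans)

  𝟘 : Series
  𝟘 _ = + 0

  𝟙 : Series
  𝟙 zero = + 1
  𝟙 (suc _) = + 0

  monomial : ℤ → ℕ → Series
  monomial σ s i = if s ℕ.≡ᵇ i then σ else + 0

  infixl 6 _⊕_
  infixr 7 ⊝_ _⊙_ x^_∙_ 1-x^_∙_ ∏1-x^_∙_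

  _⊕_ : Series → Series → Series
  (f ⊕ g) i = f i + g i

  ⊝_ : Series → Series
  (⊝ f) i = - f i

  _⊙_ : ℤ → Series → Series
  (z ⊙ f) i = z * f i

  x^_∙_ : ℕ → Series → Series
  (x^ zero ∙ f) i = f i
  (x^ suc c ∙ f) zero = + 0
  (x^ suc c ∙ f) (suc i) = (x^ c ∙ f) i

  1-x^_∙_ : ℕ → Series → Series
  1-x^ c ∙ f = f ⊕ ⊝ x^ c ∙ f

  ∏1-x^_∙_ : List ℕ → Series → Series
  ∏1-x^ [] ∙ f = f
  ∏1-x^ c ∷ cs ∙ f = 1-x^ c ∙ ∏1-x^ cs ∙ f

  infix 4 _≈[_]_
  _≈[_]_ : Series → ℕ → Series → Set
  f ≈[ D ] g = ∀ i → i < D → f i ≡ g i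

  ⊕-cong : ∀ {f f′ g g′} → f ≗ f′ → g ≗ g′ → f ⊕ g ≗ f′ ⊕ g′
  ⊕-cong p q i = cong₂ _+_ (p i) (q i)

  ⊕-congˡ : ∀ {f f′} g → f ≗ f′ → f ⊕ g ≗ f′ ⊕ g
  ⊕-congˡ g p i = cong (_+ g i) (p i)

  ⊕-congʳ : ∀ f {g g′} → g ≗ g′ → f ⊕ g ≗ f ⊕ g′
  ⊕-congʳ f q i = cong (λ y → f i + y) (q i)

  ⊕-assoc : ∀ f g h → (f ⊕ g) ⊕ h ≗ f ⊕ (g ⊕ h)
  ⊕-assoc f g h i = ℤ.+-assoc (f i) (g i) (h i)

  ⊕-comm : ∀ f g → f ⊕ g ≗ g ⊕ f
  ⊕-comm f g i = ℤ.+-comm (f i) (g i)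

  𝟘⊕ : ∀ f → 𝟘 ⊕ f ≗ f
  𝟘⊕ f i = ℤ.+-identityˡ (f i)

  ⊕𝟘 : ∀ f → f ⊕ 𝟘 ≗ f
  ⊕𝟘 f i = ℤ.+-identityʳ (f i)

  ⊕-cancel : ∀ f g h k → f ⊕ ⊝ g ≗ h ⊕ ⊝ k → f ⊕ k ≗ h ⊕ g
  ⊕-cancel f g h k p i = lemma (f i) (g i) (h i) (k i) (p i)
    where lemma : ∀ a b c d → a - b ≡ c - d → a + d ≡ c + b
          lemma a b c d e = begin
              a + d             ≡⟨ split a b d ⟩
              (a - b) + (d + b) ≡⟨ cong (_+ (d + b)) e ⟩
              (c - d) + (d + b) ≡⟨ join c d b ⟩
              c + b ∎
            where open ≡-Reasoning
                  split : ∀ a b d → a + d ≡ (a - b) + (d + b)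
                  split = solve-∀
                  join : ∀ c d b → (c - d) + (d + b) ≡ c + b
                  join = solve-∀

  ⊝-cong : ∀ {f g} → f ≗ g → ⊝ f ≗ ⊝ g
  ⊝-cong p i = cong -_ (p i)

  ⊙-cong : ∀ z {f g} → f ≗ g → z ⊙ f ≗ z ⊙ g
  ⊙-cong z p i = cong (z *_) (p i)

  1⊙ : ∀ f → + 1 ⊙ f ≗ f
  1⊙ f i = ℤ.*-identityˡ (f i)

  ≈-sym : ∀ {f g D} → f ≈[ D ] g → g ≈[ D ] f
  ≈-sym p i i<D = sym (p i i<D)

  ≈-trans : ∀ {f g h D} → f ≈[ D ] g → g ≈[ D ] h → f ≈[ D ] h
  ≈-trans p q i i<D = trans (p i i<D) (q i i<D)

  ≗⇒≈ : ∀ {f g D} → f ≗ g → f ≈[ D ] g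
  ≗⇒≈ p i _ = p i

  ⊙-≈ : ∀ z {f g D} → f ≈[ D ] g → z ⊙ f ≈[ D ] z ⊙ g
  ⊙-≈ z p i i<D = cong (z *_) (p i i<D)

  x^-cong : ∀ c {f g} → f ≗ g → x^ c ∙ f ≗ x^ c ∙ g
  x^-cong zero p i = p i
  x^-cong (suc c) p zero = refl
  x^-cong (suc c) p (suc i) = x^-cong c p i

  x^-⊕ : ∀ c f g → x^ c ∙ (f ⊕ g) ≗ x^ c ∙ f ⊕ x^ c ∙ g
  x^-⊕ zero f g i = refl
  x^-⊕ (suc c) f g zero = refl
  x^-⊕ (suc c) f g (suc i) = x^-⊕ c f g i

  x^-⊝ : ∀ c f → x^ c ∙ ⊝ f ≗ ⊝ x^ c ∙ f
  x^-⊝ zero f i = refl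
  x^-⊝ (suc c) f zero = refl
  x^-⊝ (suc c) f (suc i) = x^-⊝ c f i

  x^-⊙ : ∀ c z f → x^ c ∙ z ⊙ f ≗ z ⊙ x^ c ∙ f
  x^-⊙ zero z f i = refl
  x^-⊙ (suc c) z f zero = sym (ℤ.*-zeroʳ z)
  x^-⊙ (suc c) z f (suc i) = x^-⊙ c z f i

  x^-x^ : ∀ c d f → x^ c ∙ x^ d ∙ f ≗ x^ (c ℕ.+ d) ∙ f
  x^-x^ zero d f i = refl
  x^-x^ (suc c) d f zero = refl
  x^-x^ (suc c) d f (suc i) = x^-x^ c d f i

  x^-comm : ∀ c d f → x^ c ∙ x^ d ∙ f ≗ x^ d ∙ x^ c ∙ f
  x^-comm c d f i = trans (x^-x^ c d f i)
    (trans (cong (λ e → (x^ e ∙ f) i) (ℕ.+-comm c d)) (sym (x^-x^ d c f i)))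

  x^-𝟘 : ∀ c → x^ c ∙ 𝟘 ≗ 𝟘
  x^-𝟘 zero i = refl
  x^-𝟘 (suc c) zero = refl
  x^-𝟘 (suc c) (suc i) = x^-𝟘 c i

  x^-below : ∀ c f i → i < c → (x^ c ∙ f) i ≡ + 0
  x^-below (suc c) f zero _ = refl
  x^-below (suc c) f (suc i) (s≤s i<c) = x^-below c f i i<c

  x^-≈ : ∀ c {f g D} → f ≈[ D ] g → x^ c ∙ f ≈[ D ] x^ c ∙ g
  x^-≈ zero p = p
  x^-≈ (suc c) p zero _ = refl
  x^-≈ (suc c) p (suc i) i<D = x^-≈ c p i (ℕ.<-trans (ℕ.n<1+n i) i<D)

  ⊙x^-⊕ : ∀ σ d f g → σ ⊙ x^ d ∙ (f ⊕ g) ≗ σ ⊙ x^ d ∙ f ⊕ σ ⊙ x^ d ∙ g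
  ⊙x^-⊕ σ d f g i = trans (cong (σ *_) (x^-⊕ d f g i)) (ℤ.*-distribˡ-+ σ _ _)

  ⊝x^-additive : ∀ c → (∀ f g → ⊝ x^ c ∙ (f ⊕ g) ≗ ⊝ x^ c ∙ f ⊕ ⊝ x^ c ∙ g)
  ⊝x^-additive c f g i = trans (cong -_ (x^-⊕ c f g i)) (ℤ.neg-distrib-+ ((x^ c ∙ f) i) ((x^ c ∙ g) i))

  ⊝x^-⊙x^ : ∀ c σ d f → ⊝ x^ c ∙ σ ⊙ x^ d ∙ f ≗ (- σ) ⊙ x^ (c ℕ.+ d) ∙ f
  ⊝x^-⊙x^ c σ d f i rewrite x^-⊙ c σ (x^ d ∙ f) i | x^-x^ c d f i = ℤ.neg-distribˡ-* σ _

  ⊙x^-shift : ∀ {σ σ′} d k c d′ f → σ ≡ - σ′ → d ℕ.+ k ≡ c ℕ.+ d′ →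
              σ ⊙ x^ d ∙ x^ k ∙ f ≗ ⊝ x^ c ∙ σ′ ⊙ x^ d′ ∙ f
  ⊙x^-shift {σ} {σ′} d k c d′ f refl d+k≡c+d′ = begin
    σ ⊙ x^ d ∙ x^ k ∙ f            ≈⟨ ⊙-cong σ (x^-x^ d k f) ⟩
    σ ⊙ x^ d ℕ.+ k ∙ f             ≡⟨ cong (λ n → σ ⊙ x^ n ∙ f) d+k≡c+d′ ⟩
    σ ⊙ x^ c ℕ.+ d′ ∙ f            ≈⟨ ⊝x^-⊙x^ c σ′ d′ f ⟨
    ⊝ x^ c ∙ σ′ ⊙ x^ d′ ∙ f ∎
    where open ≗-Reasoning

  ⊝-monomial : ∀ σ s → ⊝ monomial σ s ≗ monomial (- σ) s
  ⊝-monomial σ s i with s ℕ.≡ᵇ i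
  ... | true = refl
  ... | false = refl

  monomial-at : ∀ σ s → monomial σ s s ≡ σ
  monomial-at σ s rewrite ≡ᵇ-refl s = refl

  monomial-off : ∀ σ s i → s ≢ i → monomial σ s i ≡ + 0
  monomial-off σ s i s≢i rewrite ≢⇒≡ᵇ-false s i s≢i = refl

  x^-monomial : ∀ c σ s → x^ c ∙ monomial σ s ≗ monomial σ (c ℕ.+ s)
  x^-monomial zero σ s i = refl
  x^-monomial (suc c) σ s zero = refl
  x^-monomial (suc c) σ s (suc i) = x^-monomial c σ s i

  ⊙x^-𝟙 : ∀ σ s → σ ⊙ x^ s ∙ 𝟙 ≗ monomial σ s
  ⊙x^-𝟙 σ zero zero = ℤ.*-identityʳ σ
  ⊙x^-𝟙 σ zero (suc i) = ℤ.*-zeroʳ σ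
  ⊙x^-𝟙 σ (suc s) zero = ℤ.*-zeroʳ σ
  ⊙x^-𝟙 σ (suc s) (suc i) = ⊙x^-𝟙 σ s i

  1-x^-cong : ∀ c {f g} → f ≗ g → 1-x^ c ∙ f ≗ 1-x^ c ∙ g
  1-x^-cong c p = ⊕-cong p (⊝-cong (x^-cong c p))

  1-x^-⊕ : ∀ c f g → 1-x^ c ∙ (f ⊕ g) ≗ 1-x^ c ∙ f ⊕ 1-x^ c ∙ g
  1-x^-⊕ c f g i rewrite x^-⊕ c f g i = lemma (f i) (g i) ((x^ c ∙ f) i) ((x^ c ∙ g) i)
    where lemma : ∀ a b x y → a + b - (x + y) ≡ a - x + (b - y)
          lemma = solve-∀

  1-x^-⊙ : ∀ c z f → 1-x^ c ∙ z ⊙ f ≗ z ⊙ 1-x^ c ∙ f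
  1-x^-⊙ c z f i rewrite x^-⊙ c z f i = lemma z (f i) ((x^ c ∙ f) i)
    where lemma : ∀ z a x → z * a - z * x ≡ z * (a - x)
          lemma = solve-∀

  1-x^-x^ : ∀ c d f → 1-x^ c ∙ x^ d ∙ f ≗ x^ d ∙ 1-x^ c ∙ f
  1-x^-x^ c d f i rewrite x^-⊕ d f (⊝ x^ c ∙ f) i | x^-⊝ d (x^ c ∙ f) i | x^-comm c d f i = refl

  1-x^-⊕x^ : ∀ c f d g → 1-x^ c ∙ (f ⊕ x^ d ∙ g) ≗ 1-x^ c ∙ f ⊕ x^ d ∙ 1-x^ c ∙ g
  1-x^-⊕x^ c f d g i = trans (1-x^-⊕ c f (x^ d ∙ g) i) (cong (λ y → (1-x^ c ∙ f) i + y) (1-x^-x^ c d g i))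

  1-x^-comm : ∀ c d f → 1-x^ c ∙ 1-x^ d ∙ f ≗ 1-x^ d ∙ 1-x^ c ∙ f
  1-x^-comm c d f i
    rewrite x^-⊕ c f (⊝ x^ d ∙ f) i | x^-⊝ c (x^ d ∙ f) i
          | x^-⊕ d f (⊝ x^ c ∙ f) i | x^-⊝ d (x^ c ∙ f) i | x^-comm c d f i
    = lemma (f i) ((x^ d ∙ f) i) ((x^ c ∙ f) i) ((x^ d ∙ x^ c ∙ f) i)
    where lemma : ∀ a b x y → a - b - (x - y) ≡ a - x - (b - y)
          lemma = solve-∀

  1-x^-high : ∀ c f {D} → D ≤ c → 1-x^ c ∙ f ≈[ D ] f
  1-x^-high c f D≤c i i<D rewrite x^-below c f i (ℕ.<-≤-trans i<D D≤c) = ℤ.+-identityʳ (f i)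

  1-x^-telescope : ∀ a b f → 1-x^ a ∙ f ⊕ x^ a ∙ 1-x^ b ∙ f ≗ 1-x^ (a ℕ.+ b) ∙ f
  1-x^-telescope a b f i rewrite x^-⊕ a f (⊝ x^ b ∙ f) i | x^-⊝ a (x^ b ∙ f) i | x^-x^ a b f i
    = lemma (f i) ((x^ a ∙ f) i) ((x^ (a ℕ.+ b) ∙ f) i)
    where lemma : ∀ y x z → y - x + (x - z) ≡ y - z
          lemma = solve-∀

  ∏1-x^-cong : ∀ cs {f g} → f ≗ g → ∏1-x^ cs ∙ f ≗ ∏1-x^ cs ∙ g
  ∏1-x^-cong [] p = p
  ∏1-x^-cong (c ∷ cs) p = 1-x^-cong c (∏1-x^-cong cs p)

  ∏1-x^-++ : ∀ cs ds f → ∏1-x^ (cs ++ ds) ∙ f ≡ ∏1-x^ cs ∙ ∏1-x^ ds ∙ f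
  ∏1-x^-++ [] ds f = refl
  ∏1-x^-++ (c ∷ cs) ds f = cong (1-x^ c ∙_) (∏1-x^-++ cs ds f)

  ∏1-x^-⊕ : ∀ cs f g → ∏1-x^ cs ∙ (f ⊕ g) ≗ ∏1-x^ cs ∙ f ⊕ ∏1-x^ cs ∙ g
  ∏1-x^-⊕ [] f g i = refl
  ∏1-x^-⊕ (c ∷ cs) f g i =
    trans (1-x^-cong c (∏1-x^-⊕ cs f g) i) (1-x^-⊕ c (∏1-x^ cs ∙ f) (∏1-x^ cs ∙ g) i)

  ∏1-x^-⊙ : ∀ cs z f → ∏1-x^ cs ∙ z ⊙ f ≗ z ⊙ ∏1-x^ cs ∙ f
  ∏1-x^-⊙ [] z f i = refl
  ∏1-x^-⊙ (c ∷ cs) z f i = trans (1-x^-cong c (∏1-x^-⊙ cs z f) i) (1-x^-⊙ c z (∏1-x^ cs ∙ f) i)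

  ∏1-x^-x^ : ∀ cs d f → ∏1-x^ cs ∙ x^ d ∙ f ≗ x^ d ∙ ∏1-x^ cs ∙ f
  ∏1-x^-x^ [] d f i = refl
  ∏1-x^-x^ (c ∷ cs) d f i = trans (1-x^-cong c (∏1-x^-x^ cs d f) i) (1-x^-x^ c d (∏1-x^ cs ∙ f) i)

  ∏1-x^-1-x^ : ∀ cs d f → ∏1-x^ cs ∙ 1-x^ d ∙ f ≗ 1-x^ d ∙ ∏1-x^ cs ∙ f
  ∏1-x^-1-x^ [] d f i = refl
  ∏1-x^-1-x^ (c ∷ cs) d f i =
    trans (1-x^-cong c (∏1-x^-1-x^ cs d f) i) (1-x^-comm c d (∏1-x^ cs ∙ f) i)

  ∏1-x^-⊙x^ : ∀ cs σ d f → ∏1-x^ cs ∙ σ ⊙ x^ d ∙ f ≗ σ ⊙ x^ d ∙ ∏1-x^ cs ∙ f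
  ∏1-x^-⊙x^ cs σ d f = ≗-trans (∏1-x^-⊙ cs σ (x^ d ∙ f)) (⊙-cong σ (∏1-x^-x^ cs d f))

  ∏1-x^-high : ∀ cs f {D} → All (D ≤_) cs → ∏1-x^ cs ∙ f ≈[ D ] f
  ∏1-x^-high [] f [] i _ = refl
  ∏1-x^-high (c ∷ cs) f (D≤c ∷ D≤cs) = ≈-trans (1-x^-high c _ D≤c) (∏1-x^-high cs f D≤cs)

  antidiagonal : ℕ → (ℕ → ℕ → Series) → Series
  antidiagonal zero F = F 0 0
  antidiagonal (suc L) F = F 0 (suc L) ⊕ antidiagonal L (λ r s → F (suc r) s)

  antidiagonal-cong : ∀ L {F G} → (∀ r s → r ℕ.+ s ≡ L → F r s ≗ G r s) →
                      antidiagonal L F ≗ antidiagonal L G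
  antidiagonal-cong zero p = p 0 0 refl
  antidiagonal-cong (suc L) p =
    ⊕-cong (p 0 (suc L) refl) (antidiagonal-cong L (λ r s e → p (suc r) s (cong suc e)))

  antidiagonal-⊕ : ∀ L F G → antidiagonal L (λ r s → F r s ⊕ G r s) ≗ antidiagonal L F ⊕ antidiagonal L G
  antidiagonal-⊕ zero F G i = refl
  antidiagonal-⊕ (suc L) F G i
    rewrite antidiagonal-⊕ L (λ r s → F (suc r) s) (λ r s → G (suc r) s) i
    = lemma (F 0 (suc L) i) (G 0 (suc L) i)
            (antidiagonal L (λ r s → F (suc r) s) i) (antidiagonal L (λ r s → G (suc r) s) i)
    where lemma : ∀ a b x y → a + b + (x + y) ≡ a + x + (b + y)
          lemma = solve-∀

  antidiagonal-additive : (H : Series → Series) → (∀ {f g} → f ≗ g → H f ≗ H g) →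
                          (∀ f g → H (f ⊕ g) ≗ H f ⊕ H g) →
                          ∀ L F → H (antidiagonal L F) ≗ antidiagonal L (λ r s → H (F r s))
  antidiagonal-additive H H-cong H-⊕ zero F i = refl
  antidiagonal-additive H H-cong H-⊕ (suc L) F i =
    trans (H-⊕ _ _ i) (cong (λ x → H (F 0 (suc L)) i + x) (antidiagonal-additive H H-cong H-⊕ L _ i))

  antidiagonal-suc : ∀ L F → antidiagonal (suc L) F ≗ antidiagonal L (λ r s → F r (suc s)) ⊕ F (suc L) 0
  antidiagonal-suc zero F i = refl
  antidiagonal-suc (suc L) F i rewrite antidiagonal-suc L (λ r s → F (suc r) s) i =
    sym (ℤ.+-assoc (F 0 (suc (suc L)) i) _ _)

  antidiagonal-vanishing : ∀ L F i → (∀ r s → r ℕ.+ s ≡ L → F r s i ≡ + 0) → antidiagonal L F i ≡ + 0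
  antidiagonal-vanishing zero F i h = h 0 0 refl
  antidiagonal-vanishing (suc L) F i h =
    cong₂ _+_ (h 0 (suc L) refl) (antidiagonal-vanishing L (λ r → F (suc r)) i (λ r s e → h (suc r) s (cong suc e)))

  antidiagonal-single : ∀ {L} r₀ s₀ F i → r₀ ℕ.+ s₀ ≡ L →
    (∀ r s → r ℕ.+ s ≡ L → r ≢ r₀ → F r s i ≡ + 0) → antidiagonal L F i ≡ F r₀ s₀ i
  antidiagonal-single zero zero F i refl h = refl
  antidiagonal-single zero (suc s₀) F i refl h =
    trans (cong (λ z → F 0 (suc s₀) i + z)
                (antidiagonal-vanishing s₀ (λ r → F (suc r)) i (λ r s e → h (suc r) s (cong suc e) (λ ()))))
          (ℤ.+-identityʳ (F 0 (suc s₀) i))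
  antidiagonal-single (suc r₀) s₀ F i refl h =
    trans (cong (_+ antidiagonal (r₀ ℕ.+ s₀) (λ r → F (suc r)) i) (h 0 (suc (r₀ ℕ.+ s₀)) refl (λ ())))
    (trans (ℤ.+-identityˡ _)
           (antidiagonal-single r₀ s₀ (λ r → F (suc r)) i refl
              (λ r s e r≢r₀ → h (suc r) s (cong suc e) (λ e′ → r≢r₀ (ℕ.suc-injective e′)))))

module Sign where

  open import Data.Nat using (zero; suc; _+_)
  import Data.Nat.Properties as ℕ
  open import Data.Integer using (-_)
  import Data.Integer.Properties as ℤ
  open import Relation.Binary.PropositionalEquality

  sgn-suc : ∀ k → sgn (suc k) ≡ - sgn k
  sgn-suc zero = refl
  sgn-suc (suc k) = trans (sym (ℤ.neg-involutive (sgn k))) (cong -_ (sym (sgn-suc k)))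

  sgn-+-double : ∀ a k → sgn (a + a + k) ≡ sgn k
  sgn-+-double zero k = refl
  sgn-+-double (suc a) k rewrite ℕ.+-suc a a = sgn-+-double a k

  sgn-suc-+-suc : ∀ r b → sgn (suc r + suc b) ≡ sgn (r + b)
  sgn-suc-+-suc r b rewrite ℕ.+-suc r b = refl

module GaussianBinomial (m′ : ℕ) where

  open PowerSeries
  open import Data.Nat using (zero; suc; _+_; _*_; _∸_; _≤_; s≤s)
  import Data.Nat.Properties as ℕ
  open import Data.Nat.Tactic.RingSolver using (solve-∀)
  open import Data.List using (List; []; _∷_; _++_; applyDownFrom)
  open import Data.List.Relation.Unary.All using (All; []; _∷_)
  open import Relation.Binary.PropositionalEquality

  m : ℕ
  m = suc m′

  -- qBinomial r s is the Gaussian binomial coefficient [r + s, r] in q = x^m.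
  qBinomial : ℕ → ℕ → Series
  qBinomial zero s = 𝟙
  qBinomial (suc r) zero = 𝟙
  qBinomial (suc r) (suc s) = qBinomial r (suc s) ⊕ x^ m * suc r ∙ qBinomial (suc r) s

  qBinomial-zeroʳ : ∀ r → qBinomial r 0 ≡ 𝟙
  qBinomial-zeroʳ zero = refl
  qBinomial-zeroʳ (suc r) = refl

  1-x^-qBinomial-oneˡ : ∀ s → 1-x^ m ∙ qBinomial 1 s ≗ 1-x^ m * suc s ∙ 𝟙
  1-x^-qBinomial-oneˡ zero i = cong (λ c → (1-x^ c ∙ 𝟙) i) (sym (ℕ.*-identityʳ m))
  1-x^-qBinomial-oneˡ (suc s) = begin
    1-x^ m ∙ (𝟙 ⊕ x^ m * 1 ∙ qBinomial 1 s)
      ≈⟨ 1-x^-⊕x^ m 𝟙 (m * 1) (qBinomial 1 s) ⟩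
    1-x^ m ∙ 𝟙 ⊕ x^ m * 1 ∙ 1-x^ m ∙ qBinomial 1 s
      ≡⟨ cong (λ c → 1-x^ m ∙ 𝟙 ⊕ x^ c ∙ 1-x^ m ∙ qBinomial 1 s) (ℕ.*-identityʳ m) ⟩
    1-x^ m ∙ 𝟙 ⊕ x^ m ∙ 1-x^ m ∙ qBinomial 1 s
      ≈⟨ ⊕-congʳ (1-x^ m ∙ 𝟙) (x^-cong m (1-x^-qBinomial-oneˡ s)) ⟩
    1-x^ m ∙ 𝟙 ⊕ x^ m ∙ 1-x^ m * suc s ∙ 𝟙
      ≈⟨ 1-x^-telescope m (m * suc s) 𝟙 ⟩
    1-x^ m + m * suc s ∙ 𝟙
      ≡⟨ cong (1-x^_∙ 𝟙) (sym (ℕ.*-suc m (suc s))) ⟩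
    1-x^ m * suc (suc s) ∙ 𝟙 ∎
    where open ≗-Reasoning

  1-x^-qBinomial-oneʳ : ∀ r → 1-x^ m ∙ qBinomial r 1 ≗ 1-x^ m * suc r ∙ 𝟙
  1-x^-qBinomial-oneʳ zero i = cong (λ c → (1-x^ c ∙ 𝟙) i) (sym (ℕ.*-identityʳ m))
  1-x^-qBinomial-oneʳ (suc r) = begin
    1-x^ m ∙ (qBinomial r 1 ⊕ x^ m * suc r ∙ 𝟙)
      ≈⟨ 1-x^-⊕x^ m (qBinomial r 1) (m * suc r) 𝟙 ⟩
    1-x^ m ∙ qBinomial r 1 ⊕ x^ m * suc r ∙ 1-x^ m ∙ 𝟙
      ≈⟨ ⊕-congˡ (x^ m * suc r ∙ 1-x^ m ∙ 𝟙) (1-x^-qBinomial-oneʳ r) ⟩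
    1-x^ m * suc r ∙ 𝟙 ⊕ x^ m * suc r ∙ 1-x^ m ∙ 𝟙
      ≈⟨ 1-x^-telescope (m * suc r) m 𝟙 ⟩
    1-x^ m * suc r + m ∙ 𝟙
      ≡⟨ cong (1-x^_∙ 𝟙) (lemma m r) ⟩
    1-x^ m * suc (suc r) ∙ 𝟙 ∎
    where open ≗-Reasoning
          lemma : ∀ m r → m * suc r + m ≡ m * suc (suc r)
          lemma = solve-∀

  qBinomial-absorption : ∀ r s → 1-x^ m * suc s ∙ qBinomial r (suc s) ≗ 1-x^ m * suc r ∙ qBinomial (suc r) s
  qBinomial-absorption zero s = begin
    1-x^ m * suc s ∙ 𝟙            ≈⟨ 1-x^-qBinomial-oneˡ s ⟨
    1-x^ m ∙ qBinomial 1 s        ≡⟨ cong (1-x^_∙ qBinomial 1 s) (sym (ℕ.*-identityʳ m)) ⟩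
    1-x^ m * 1 ∙ qBinomial 1 s ∎
    where open ≗-Reasoning
  qBinomial-absorption (suc r) zero = begin
    1-x^ m * 1 ∙ qBinomial (suc r) 1   ≡⟨ cong (1-x^_∙ qBinomial (suc r) 1) (ℕ.*-identityʳ m) ⟩
    1-x^ m ∙ qBinomial (suc r) 1       ≈⟨ 1-x^-qBinomial-oneʳ (suc r) ⟩
    1-x^ m * suc (suc r) ∙ 𝟙 ∎
    where open ≗-Reasoning
  qBinomial-absorption (suc r) (suc s) = begin
    1-x^ b′ ∙ (qBinomial r (suc (suc s)) ⊕ x^ a ∙ G)
      ≈⟨ 1-x^-⊕x^ b′ (qBinomial r (suc (suc s))) a G ⟩
    1-x^ b′ ∙ qBinomial r (suc (suc s)) ⊕ x^ a ∙ 1-x^ b′ ∙ G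
      ≈⟨ ⊕-congˡ (x^ a ∙ 1-x^ b′ ∙ G) (qBinomial-absorption r (suc s)) ⟩
    1-x^ a ∙ G ⊕ x^ a ∙ 1-x^ b′ ∙ G
      ≈⟨ 1-x^-telescope a b′ G ⟩
    1-x^ a + b′ ∙ G
      ≡⟨ cong (1-x^_∙ G) (lemma m r s) ⟩
    1-x^ a′ + b ∙ G
      ≈⟨ 1-x^-telescope a′ b G ⟨
    1-x^ a′ ∙ G ⊕ x^ a′ ∙ 1-x^ b ∙ G
      ≈⟨ ⊕-congʳ (1-x^ a′ ∙ G) (x^-cong a′ (qBinomial-absorption (suc r) s)) ⟩
    1-x^ a′ ∙ G ⊕ x^ a′ ∙ 1-x^ a′ ∙ qBinomial (suc (suc r)) s
      ≈⟨ 1-x^-⊕x^ a′ G a′ (qBinomial (suc (suc r)) s) ⟨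
    1-x^ a′ ∙ (G ⊕ x^ a′ ∙ qBinomial (suc (suc r)) s) ∎
    where open ≗-Reasoning
          a a′ b b′ : ℕ
          a = m * suc r
          a′ = m * suc (suc r)
          b = m * suc s
          b′ = m * suc (suc s)
          G : Series
          G = qBinomial (suc r) (suc s)
          lemma : ∀ m r s → m * suc r + m * suc (suc s) ≡ m * suc (suc r) + m * suc s
          lemma = solve-∀

  qBinomial-pascal-mirror : ∀ r s →
    qBinomial (suc r) (suc s) ≗ qBinomial (suc r) s ⊕ x^ m * suc s ∙ qBinomial r (suc s)
  qBinomial-pascal-mirror r s =
    ⊕-cancel (qBinomial r (suc s)) (x^ m * suc s ∙ qBinomial r (suc s))
             (qBinomial (suc r) s) (x^ m * suc r ∙ qBinomial (suc r) s) (qBinomial-absorption r s)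

  residue₀ : ℕ → List ℕ
  residue₀ = applyDownFrom (λ i → m * suc i)

  multiplesAfter : ℕ → ℕ → List ℕ
  multiplesAfter r zero = []
  multiplesAfter r (suc s) = m * suc r ∷ multiplesAfter (suc r) s

  multiplesAfter-suc : ∀ r s → multiplesAfter r (suc s) ≡ multiplesAfter r s ++ m * suc (r + s) ∷ []
  multiplesAfter-suc r zero rewrite ℕ.+-identityʳ r = refl
  multiplesAfter-suc r (suc s) rewrite multiplesAfter-suc (suc r) s | ℕ.+-suc r s = refl

  ∏1-x^-multiplesAfter-suc : ∀ r s f →
    ∏1-x^ multiplesAfter r (suc s) ∙ f ≗ 1-x^ m * suc (r + s) ∙ ∏1-x^ multiplesAfter r s ∙ f
  ∏1-x^-multiplesAfter-suc r s f = begin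
    ∏1-x^ multiplesAfter r (suc s) ∙ f                       ≡⟨ cong (∏1-x^_∙ f) (multiplesAfter-suc r s) ⟩
    ∏1-x^ multiplesAfter r s ++ c ∷ [] ∙ f                    ≡⟨ ∏1-x^-++ (multiplesAfter r s) (c ∷ []) f ⟩
    ∏1-x^ multiplesAfter r s ∙ 1-x^ c ∙ f                     ≈⟨ ∏1-x^-1-x^ (multiplesAfter r s) c f ⟩
    1-x^ c ∙ ∏1-x^ multiplesAfter r s ∙ f ∎
    where open ≗-Reasoning
          c : ℕ
          c = m * suc (r + s)

  ∏1-x^-residue₀ : ∀ s f → ∏1-x^ residue₀ s ∙ f ≗ ∏1-x^ multiplesAfter 0 s ∙ f
  ∏1-x^-residue₀ zero f i = refl
  ∏1-x^-residue₀ (suc s) f =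
    ≗-trans (1-x^-cong (m * suc s) (∏1-x^-residue₀ s f)) (≗-sym (∏1-x^-multiplesAfter-suc 0 s f))

  ∏1-x^-residue₀-qBinomial : ∀ r s → ∏1-x^ residue₀ s ∙ qBinomial r s ≗ ∏1-x^ multiplesAfter r s ∙ 𝟙
  ∏1-x^-residue₀-qBinomial zero s = ∏1-x^-residue₀ s 𝟙
  ∏1-x^-residue₀-qBinomial (suc r) zero i = refl
  ∏1-x^-residue₀-qBinomial (suc r) (suc s) = begin
    ∏1-x^ residue₀ (suc s) ∙ (qBinomial r (suc s) ⊕ x^ a ∙ qBinomial (suc r) s)
      ≈⟨ ∏1-x^-⊕ (residue₀ (suc s)) (qBinomial r (suc s)) (x^ a ∙ qBinomial (suc r) s) ⟩
    ∏1-x^ residue₀ (suc s) ∙ qBinomial r (suc s) ⊕ ∏1-x^ residue₀ (suc s) ∙ x^ a ∙ qBinomial (suc r) s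
      ≈⟨ ⊕-cong (∏1-x^-residue₀-qBinomial r (suc s)) (∏1-x^-x^ (residue₀ (suc s)) a (qBinomial (suc r) s)) ⟩
    ∏1-x^ multiplesAfter r (suc s) ∙ 𝟙 ⊕ x^ a ∙ 1-x^ b ∙ ∏1-x^ residue₀ s ∙ qBinomial (suc r) s
      ≈⟨ ⊕-congʳ (∏1-x^ multiplesAfter r (suc s) ∙ 𝟙)
           (x^-cong a (1-x^-cong b (∏1-x^-residue₀-qBinomial (suc r) s))) ⟩
    1-x^ a ∙ Π ⊕ x^ a ∙ 1-x^ b ∙ Π
      ≈⟨ 1-x^-telescope a b Π ⟩
    1-x^ a + b ∙ Π
      ≡⟨ cong (1-x^_∙ Π) (lemma m r s) ⟩
    1-x^ m * suc (suc r + s) ∙ Π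
      ≈⟨ ∏1-x^-multiplesAfter-suc (suc r) s 𝟙 ⟨
    ∏1-x^ multiplesAfter (suc r) (suc s) ∙ 𝟙 ∎
    where open ≗-Reasoning
          a b : ℕ
          a = m * suc r
          b = m * suc s
          Π : Series
          Π = ∏1-x^ multiplesAfter (suc r) s ∙ 𝟙
          lemma : ∀ m r s → m * suc r + m * suc s ≡ m * suc (suc r + s)
          lemma = solve-∀

  multiplesAfter-≥ : ∀ r s D → D ≤ m * suc r → All (D ≤_) (multiplesAfter r s)
  multiplesAfter-≥ r zero D D≤ = []
  multiplesAfter-≥ r (suc s) D D≤ =
    D≤ ∷ multiplesAfter-≥ (suc r) s D (ℕ.≤-trans D≤ (ℕ.*-monoʳ-≤ m (ℕ.n≤1+n (suc r))))

  ∏1-x^-residue₀-+ : ∀ k s f {D} → D ≤ m * suc s → ∏1-x^ residue₀ (k + s) ∙ f ≈[ D ] ∏1-x^ residue₀ s ∙ f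
  ∏1-x^-residue₀-+ zero s f D≤ i _ = refl
  ∏1-x^-residue₀-+ (suc k) s f D≤ = ≈-trans
    (1-x^-high (m * suc (k + s)) _ (ℕ.≤-trans D≤ (ℕ.*-monoʳ-≤ m (s≤s (ℕ.m≤n+m s k)))))
    (∏1-x^-residue₀-+ k s f D≤)

  -- Below degree m · (1 + min(r, s, M)) the product equals (q^(r+1); q)_s, which is 1 there.
  ∏1-x^-residue₀-qBinomial-≈𝟙 : ∀ M r s D → D ≤ m * suc r → D ≤ m * suc s → D ≤ m * suc M →
                               ∏1-x^ residue₀ M ∙ qBinomial r s ≈[ D ] 𝟙
  ∏1-x^-residue₀-qBinomial-≈𝟙 M r s D D≤r D≤s D≤M with ℕ.≤-total M s
  ... | inj₁ M≤s = subst (λ n → ∏1-x^ residue₀ M ∙ qBinomial r n ≈[ D ] 𝟙) (ℕ.m∸n+n≡m M≤s)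
          (≈-trans (≈-sym (∏1-x^-residue₀-+ (s ∸ M) M (qBinomial r (s ∸ M + M)) D≤M))
          (≈-trans (≗⇒≈ (∏1-x^-residue₀-qBinomial r (s ∸ M + M)))
                   (∏1-x^-high (multiplesAfter r (s ∸ M + M)) 𝟙 (multiplesAfter-≥ r (s ∸ M + M) D D≤r))))
  ... | inj₂ s≤M = subst (λ n → ∏1-x^ residue₀ n ∙ qBinomial r s ≈[ D ] 𝟙) (ℕ.m∸n+n≡m s≤M)
          (≈-trans (∏1-x^-residue₀-+ (M ∸ s) s (qBinomial r s) D≤s)
          (≈-trans (≗⇒≈ (∏1-x^-residue₀-qBinomial r s))
                   (∏1-x^-high (multiplesAfter r s) 𝟙 (multiplesAfter-≥ r s D D≤r))))

module TripleProduct (m′ : ℕ) where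

  open PowerSeries
  open Sign
  open GaussianBinomial m′
  open import Data.Nat using (zero; suc; _+_; _*_; _≤_; _<_; s≤s; z≤n)
  import Data.Nat.Properties as ℕ
  open import Data.Nat.Tactic.RingSolver using (solve-∀)
  import Data.Integer.Properties as ℤ
  open import Data.List using (List; applyDownFrom)
  open import Relation.Binary.PropositionalEquality

  P′ : ℕ → ℕ
  P′ zero = 0
  P′ (suc k) = P′ k + suc (m * k)

  Q′ : ℕ → ℕ
  Q′ zero = 0
  Q′ (suc j) = m * j + m′ + Q′ j

  -- The exponent of the term with index k = r − b of the triple product:
  -- P′ k for k ≥ 0 and Q′ (− k) for k < 0.
  e : ℕ → ℕ → ℕ
  e r zero = P′ r
  e zero (suc b) = Q′ (suc b)
  e (suc r) (suc b) = e r b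

  e-zeroˡ : ∀ b → e 0 b ≡ Q′ b
  e-zeroˡ zero = refl
  e-zeroˡ (suc b) = refl

  e-sucˡ : ∀ r b → e (suc r) b + m * b ≡ e r b + suc (m * r)
  e-sucˡ r zero = lemma m (P′ r) r
    where lemma : ∀ m x r → x + suc (m * r) + m * 0 ≡ x + suc (m * r)
          lemma = solve-∀
  e-sucˡ zero (suc b) rewrite e-zeroˡ b = lemma m′ (Q′ b) b
    where lemma : ∀ m′ x b → x + suc m′ * suc b ≡ suc m′ * b + m′ + x + suc (suc m′ * 0)
          lemma = solve-∀
  e-sucˡ (suc r) (suc b) = begin
    e (suc r) b + m * suc b        ≡⟨ lemma₁ m (e (suc r) b) b ⟩
    m + (e (suc r) b + m * b)      ≡⟨ cong (λ n → m + n) (e-sucˡ r b) ⟩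
    m + (e r b + suc (m * r))      ≡⟨ lemma₂ m (e r b) r ⟩
    e r b + suc (m * suc r) ∎
    where open ≡-Reasoning
          lemma₁ : ∀ m x b → x + m * suc b ≡ m + (x + m * b)
          lemma₁ = solve-∀
          lemma₂ : ∀ m y r → m + (y + suc (m * r)) ≡ y + suc (m * suc r)
          lemma₂ = solve-∀

  e-stepˡ : ∀ r s a b → r + s ≡ a + b → e (suc r) b + m * s ≡ (m * a + 1) + e r b
  e-stepˡ r s a b r+s≡a+b = ℕ.+-cancelʳ-≡ (m * b) _ _ (begin
    e (suc r) b + m * s + m * b    ≡⟨ lemma₁ (e (suc r) b) (m * s) (m * b) ⟩
    e (suc r) b + m * b + m * s    ≡⟨ cong (_+ m * s) (e-sucˡ r b) ⟩
    e r b + suc (m * r) + m * s    ≡⟨ lemma₂ m (e r b) r s ⟩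
    e r b + 1 + m * (r + s)        ≡⟨ cong (λ n → e r b + 1 + m * n) r+s≡a+b ⟩
    e r b + 1 + m * (a + b)        ≡⟨ lemma₃ m (e r b) a b ⟩
    m * a + 1 + e r b + m * b      ∎)
    where open ≡-Reasoning
          lemma₁ : ∀ x y z → x + y + z ≡ x + z + y
          lemma₁ = solve-∀
          lemma₂ : ∀ m x r s → x + suc (m * r) + m * s ≡ x + 1 + m * (r + s)
          lemma₂ = solve-∀
          lemma₃ : ∀ m x a b → x + 1 + m * (a + b) ≡ m * a + 1 + x + m * b
          lemma₃ = solve-∀

  e-stepʳ : ∀ r b → e r b + m * suc r ≡ (m * b + m′) + e (suc r) b
  e-stepʳ r b = begin
    e r b + m * suc r                ≡⟨ lemma₁ m′ (e r b) r ⟩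
    e r b + suc (m * r) + m′         ≡⟨ cong (_+ m′) (e-sucˡ r b) ⟨
    e (suc r) b + m * b + m′         ≡⟨ lemma₂ (e (suc r) b) (m * b) m′ ⟩
    m * b + m′ + e (suc r) b ∎
    where open ≡-Reasoning
          lemma₁ : ∀ m′ x r → x + suc m′ * suc r ≡ x + suc (suc m′ * r) + m′
          lemma₁ = solve-∀
          lemma₂ : ∀ x y z → x + y + z ≡ y + z + x
          lemma₂ = solve-∀

  e-above : ∀ b k → e (b + k) b ≡ P′ k
  e-above zero k = refl
  e-above (suc b) k = e-above b k

  e-below : ∀ r j → e r (r + j) ≡ Q′ j
  e-below zero j = e-zeroˡ j
  e-below (suc r) j = e-below r j

  P′-step : ∀ k → P′ k < P′ (suc k)
  P′-step k = ℕ.m<m+n (P′ k) (s≤s z≤n)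

  ≤-P′ : ∀ k → k ≤ P′ k
  ≤-P′ zero = z≤n
  ≤-P′ (suc k) = subst (_≤ P′ (suc k)) (ℕ.+-comm k 1) (ℕ.+-mono-≤ (≤-P′ k) (s≤s z≤n))

  ≤-e+ʳ : ∀ r b → r ≤ e r b + b
  ≤-e+ʳ r zero = ℕ.≤-trans (≤-P′ r) (ℕ.m≤m+n (P′ r) 0)
  ≤-e+ʳ zero (suc b) = z≤n
  ≤-e+ʳ (suc r) (suc b) = subst (suc r ≤_) (sym (ℕ.+-suc (e r b) b)) (s≤s (≤-e+ʳ r b))

  term : ℕ → ℕ → ℕ → Series
  term b r s = sgn (r + b) ⊙ x^ e r b ∙ qBinomial r s

  -- Pascal's rule splits term b r (1 + s) into term b r s plus tailˡ b r s; summed over the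
  -- antidiagonal, the tails recombine into − x^(m a + 1) times the previous sum.
  tailˡ : ℕ → ℕ → ℕ → Series
  tailˡ b zero s = 𝟘
  tailˡ b (suc r) s = sgn (suc r + b) ⊙ x^ e (suc r) b ∙ x^ m * suc s ∙ qBinomial r (suc s)

  term-sucʳ : ∀ b r s → term b r (suc s) ≗ term b r s ⊕ tailˡ b r s
  term-sucʳ b zero s i = sym (ℤ.+-identityʳ _)
  term-sucʳ b (suc r) s i =
    trans (⊙-cong σ (x^-cong (e (suc r) b) (qBinomial-pascal-mirror r s)) i)
          (⊙x^-⊕ σ (e (suc r) b) (qBinomial (suc r) s) (x^ m * suc s ∙ qBinomial r (suc s)) i)
    where σ : ℤ
          σ = sgn (suc r + b)

  term-shiftˡ : ∀ a b r s f → r + s ≡ a + b →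
    sgn (suc r + b) ⊙ x^ e (suc r) b ∙ x^ m * s ∙ f ≗ ⊝ x^ m * a + 1 ∙ sgn (r + b) ⊙ x^ e r b ∙ f
  term-shiftˡ a b r s f r+s≡a+b =
    ⊙x^-shift (e (suc r) b) (m * s) (m * a + 1) (e r b) f (sgn-suc (r + b)) (e-stepˡ r s a b r+s≡a+b)

  x^-m*0 : ∀ f → x^ m * 0 ∙ f ≗ f
  x^-m*0 f i = cong (λ c → (x^ c ∙ f) i) (ℕ.*-zeroʳ m)

  antidiagonal-tailˡ : ∀ a b L → L ≡ a + b →
    antidiagonal L (tailˡ b) ⊕ term b (suc L) 0 ≗ ⊝ x^ m * a + 1 ∙ antidiagonal L (term b)
  antidiagonal-tailˡ a b zero 0≡a+b = begin
    𝟘 ⊕ term b 1 0                                 ≈⟨ 𝟘⊕ (term b 1 0) ⟩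
    σ ⊙ x^ e 1 b ∙ 𝟙                               ≈⟨ ⊙-cong σ (x^-cong (e 1 b) (x^-m*0 𝟙)) ⟨
    σ ⊙ x^ e 1 b ∙ x^ m * 0 ∙ 𝟙                    ≈⟨ term-shiftˡ a b 0 0 𝟙 0≡a+b ⟩
    ⊝ x^ m * a + 1 ∙ term b 0 0 ∎
    where open ≗-Reasoning
          σ : ℤ
          σ = sgn (1 + b)
  antidiagonal-tailˡ a b (suc L) L+1≡a+b = begin
    (𝟘 ⊕ antidiagonal L (λ r → tailˡ b (suc r))) ⊕ term b (suc (suc L)) 0
      ≈⟨ ⊕-congˡ (term b (suc (suc L)) 0) (𝟘⊕ (antidiagonal L (λ r → tailˡ b (suc r)))) ⟩
    antidiagonal L (λ r → tailˡ b (suc r)) ⊕ term b (suc (suc L)) 0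
      ≈⟨ ⊕-congˡ (term b (suc (suc L)) 0) (antidiagonal-cong L λ r s r+s≡L →
           term-shiftˡ a b r (suc s) (qBinomial r (suc s)) (trans (ℕ.+-suc r s) (trans (cong suc r+s≡L) L+1≡a+b))) ⟩
    antidiagonal L (λ r s → ⊝ x^ c ∙ term b r (suc s)) ⊕ σ ⊙ x^ e (suc (suc L)) b ∙ 𝟙
      ≈⟨ ⊕-congʳ A (⊙-cong σ (x^-cong (e (suc (suc L)) b) (x^-m*0 𝟙))) ⟨
    antidiagonal L (λ r s → ⊝ x^ c ∙ term b r (suc s)) ⊕ σ ⊙ x^ e (suc (suc L)) b ∙ x^ m * 0 ∙ 𝟙
      ≈⟨ ⊕-congʳ A (term-shiftˡ a b (suc L) 0 𝟙 (trans (ℕ.+-identityʳ (suc L)) L+1≡a+b)) ⟩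
    antidiagonal L (λ r s → ⊝ x^ c ∙ term b r (suc s)) ⊕ ⊝ x^ c ∙ term b (suc L) 0
      ≈⟨ antidiagonal-suc L (λ r s → ⊝ x^ c ∙ term b r s) ⟨
    antidiagonal (suc L) (λ r s → ⊝ x^ c ∙ term b r s)
      ≈⟨ antidiagonal-additive (λ f → ⊝ x^ c ∙ f) (λ p → ⊝-cong (x^-cong c p)) (⊝x^-additive c) (suc L) (term b) ⟨
    ⊝ x^ c ∙ antidiagonal (suc L) (term b) ∎
    where open ≗-Reasoning
          σ : ℤ
          σ = sgn (suc (suc L) + b)
          c : ℕ
          c = m * a + 1
          A : Series
          A = antidiagonal L (λ r s → ⊝ x^ c ∙ term b r (suc s))

  antidiagonal-term-sucˡ : ∀ a b →
    antidiagonal (suc (a + b)) (term b) ≗ 1-x^ m * a + 1 ∙ antidiagonal (a + b) (term b)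
  antidiagonal-term-sucˡ a b = begin
    antidiagonal (suc L) (term b)
      ≈⟨ antidiagonal-suc L (term b) ⟩
    antidiagonal L (λ r s → term b r (suc s)) ⊕ term b (suc L) 0
      ≈⟨ ⊕-congˡ (term b (suc L) 0) (antidiagonal-cong L (λ r s _ → term-sucʳ b r s)) ⟩
    antidiagonal L (λ r s → term b r s ⊕ tailˡ b r s) ⊕ term b (suc L) 0
      ≈⟨ ⊕-congˡ (term b (suc L) 0) (antidiagonal-⊕ L (term b) (tailˡ b)) ⟩
    (antidiagonal L (term b) ⊕ antidiagonal L (tailˡ b)) ⊕ term b (suc L) 0
      ≈⟨ ⊕-assoc (antidiagonal L (term b)) (antidiagonal L (tailˡ b)) (term b (suc L) 0) ⟩
    antidiagonal L (term b) ⊕ (antidiagonal L (tailˡ b) ⊕ term b (suc L) 0)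
      ≈⟨ ⊕-congʳ (antidiagonal L (term b)) (antidiagonal-tailˡ a b L refl) ⟩
    1-x^ m * a + 1 ∙ antidiagonal L (term b) ∎
    where open ≗-Reasoning
          L : ℕ
          L = a + b

  -- Likewise term (1 + b) (1 + r) s = term b r s + tailʳ b r s, and these tails recombine
  -- into − x^(m b + m − 1) times the previous sum.
  tailʳ : ℕ → ℕ → ℕ → Series
  tailʳ b r zero = 𝟘
  tailʳ b r (suc s) = sgn (suc r + suc b) ⊙ x^ e r b ∙ x^ m * suc r ∙ qBinomial (suc r) s

  term-sucˡ : ∀ b r s → term (suc b) (suc r) s ≗ term b r s ⊕ tailʳ b r s
  term-sucˡ b r zero i rewrite qBinomial-zeroʳ r | sgn-suc-+-suc r b = sym (ℤ.+-identityʳ _)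
  term-sucˡ b r (suc s) =
    ≗-trans (⊙x^-⊕ σ (e r b) (qBinomial r (suc s)) (x^ m * suc r ∙ qBinomial (suc r) s))
    (⊕-congˡ (tailʳ b r (suc s)) (λ i → cong (λ τ → (τ ⊙ x^ e r b ∙ qBinomial r (suc s)) i) (sgn-suc-+-suc r b)))
    where σ : ℤ
          σ = sgn (suc r + suc b)

  term-zero-shiftʳ : ∀ b L → term (suc b) 0 (suc L) ≗ ⊝ x^ m * b + m′ ∙ term b 0 L
  term-zero-shiftʳ b L = ⊙x^-shift (Q′ (suc b)) 0 (m * b + m′) (e 0 b) 𝟙 (sgn-suc b)
    (trans (ℕ.+-identityʳ (Q′ (suc b))) (cong (λ n → m * b + m′ + n) (sym (e-zeroˡ b))))

  tailʳ-shift : ∀ b r s → tailʳ b r (suc s) ≗ ⊝ x^ m * b + m′ ∙ term b (suc r) s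
  tailʳ-shift b r s = ⊙x^-shift (e r b) (m * suc r) (m * b + m′) (e (suc r) b) (qBinomial (suc r) s)
    (trans (cong sgn (ℕ.+-suc (suc r) b)) (sgn-suc (suc r + b))) (e-stepʳ r b)

  antidiagonal-tailʳ : ∀ b L →
    term (suc b) 0 (suc L) ⊕ antidiagonal L (tailʳ b) ≗ ⊝ x^ m * b + m′ ∙ antidiagonal L (term b)
  antidiagonal-tailʳ b zero = ≗-trans (⊕𝟘 (term (suc b) 0 1)) (term-zero-shiftʳ b 0)
  antidiagonal-tailʳ b (suc L) = begin
    T ⊕ antidiagonal (suc L) (tailʳ b)
      ≈⟨ ⊕-congʳ T (antidiagonal-suc L (tailʳ b)) ⟩
    T ⊕ (antidiagonal L (λ r s → tailʳ b r (suc s)) ⊕ 𝟘)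
      ≈⟨ ⊕-congʳ T (⊕𝟘 (antidiagonal L (λ r s → tailʳ b r (suc s)))) ⟩
    T ⊕ antidiagonal L (λ r s → tailʳ b r (suc s))
      ≈⟨ ⊕-cong (term-zero-shiftʳ b (suc L)) (antidiagonal-cong L (λ r s _ → tailʳ-shift b r s)) ⟩
    antidiagonal (suc L) (λ r s → ⊝ x^ c ∙ term b r s)
      ≈⟨ antidiagonal-additive (λ f → ⊝ x^ c ∙ f) (λ p → ⊝-cong (x^-cong c p)) (⊝x^-additive c) (suc L) (term b) ⟨
    ⊝ x^ c ∙ antidiagonal (suc L) (term b) ∎
    where open ≗-Reasoning
          T : Series
          T = term (suc b) 0 (suc (suc L))
          c : ℕ
          c = m * b + m′

  antidiagonal-term-sucʳ : ∀ b L →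
    antidiagonal (suc L) (term (suc b)) ≗ 1-x^ m * b + m′ ∙ antidiagonal L (term b)
  antidiagonal-term-sucʳ b L = begin
    T ⊕ antidiagonal L (λ r s → term (suc b) (suc r) s)
      ≈⟨ ⊕-congʳ T (antidiagonal-cong L (λ r s _ → term-sucˡ b r s)) ⟩
    T ⊕ antidiagonal L (λ r s → term b r s ⊕ tailʳ b r s)
      ≈⟨ ⊕-congʳ T (antidiagonal-⊕ L (term b) (tailʳ b)) ⟩
    T ⊕ (A ⊕ antidiagonal L (tailʳ b))
      ≈⟨ ⊕-assoc T A (antidiagonal L (tailʳ b)) ⟨
    (T ⊕ A) ⊕ antidiagonal L (tailʳ b)
      ≈⟨ ⊕-congˡ (antidiagonal L (tailʳ b)) (⊕-comm T A) ⟩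
    (A ⊕ T) ⊕ antidiagonal L (tailʳ b)
      ≈⟨ ⊕-assoc A T (antidiagonal L (tailʳ b)) ⟩
    A ⊕ (T ⊕ antidiagonal L (tailʳ b))
      ≈⟨ ⊕-congʳ A (antidiagonal-tailʳ b L) ⟩
    1-x^ m * b + m′ ∙ A ∎
    where open ≗-Reasoning
          T A : Series
          T = term (suc b) 0 (suc L)
          A = antidiagonal L (term b)

  residue₁ residue₋₁ : ℕ → List ℕ
  residue₁ = applyDownFrom (λ j → m * j + 1)
  residue₋₁ = applyDownFrom (λ j → m * j + m′)

  finite-triple-product : ∀ a b →
    ∏1-x^ residue₁ a ∙ ∏1-x^ residue₋₁ b ∙ 𝟙 ≗ antidiagonal (a + b) (term b)
  finite-triple-product zero zero = ≗-sym (1⊙ 𝟙)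
  finite-triple-product zero (suc b) =
    ≗-trans (1-x^-cong (m * b + m′) (finite-triple-product zero b)) (≗-sym (antidiagonal-term-sucʳ b b))
  finite-triple-product (suc a) b =
    ≗-trans (1-x^-cong (m * a + 1) (finite-triple-product a b)) (≗-sym (antidiagonal-term-sucˡ a b))
module SignedCount where

  open import Data.Integer using (-_; _-_; _+_)
  import Data.Integer.Properties as ℤ
  open import Data.Integer.Tactic.RingSolver using (solve-∀)
  open import Data.Bool using (Bool; true; false; if_then_else_)
  open import Data.Bool.Properties using (T?)
  open import Data.List using (List; []; _∷_; length; filter)
  open import Relation.Binary.PropositionalEquality

  signedSum : {A : Set} → (A → Bool) → (A → ℕ) → List A → ℤ
  signedSum q len [] = + 0
  signedSum q len (x ∷ xs) = (if q x then sgn (len x) else + 0) + signedSum q len xs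

  evenCount oddCount : {A : Set} → (A → ℕ) → List A → ℕ
  evenCount len ys = length (filter (λ y → T? (evenᵇ (len y))) ys)
  oddCount len ys = length (filter (λ y → T? (if evenᵇ (len y) then false else true)) ys)

  evenCount-minus-oddCount : ∀ {A : Set} (q : A → Bool) (len : A → ℕ) xs →
    let ys = filter (λ x → T? (q x)) xs in + evenCount len ys - + oddCount len ys ≡ signedSum q len xs
  evenCount-minus-oddCount q len [] = refl
  evenCount-minus-oddCount {A} q len (x ∷ xs) with q x
  ... | false = trans (evenCount-minus-oddCount q len xs) (sym (ℤ.+-identityˡ _))
  ... | true with evenᵇ (len x)
  ...   | true = trans (lemma (+ evenCount len ys) (+ oddCount len ys))
                       (cong (λ z → + 1 + z) (evenCount-minus-oddCount q len xs))
    where ys : List A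
          ys = filter (λ x → T? (q x)) xs
          lemma : ∀ a b → + 1 + a - b ≡ + 1 + (a - b)
          lemma = solve-∀
  ...   | false = trans (lemma (+ evenCount len ys) (+ oddCount len ys))
                        (cong (λ z → - + 1 + z) (evenCount-minus-oddCount q len xs))
    where ys : List A
          ys = filter (λ x → T? (q x)) xs
          lemma : ∀ a b → a - (+ 1 + b) ≡ - + 1 + (a - b)
          lemma = solve-∀

module PartitionGeneratingFunction (m : ℕ) .{{_ : NonZero m}} where

  open PowerSeries
  open Sign
  open SignedCount
  open import Data.Nat as ℕ using (zero; suc; _≡ᵇ_; s≤s)
  import Data.Nat.Properties as ℕ
  open import Data.Nat.ListAction using (sum)
  open import Data.Integer using (-_; _+_)
  import Data.Integer.Properties as ℤ
  open import Data.Bool using (Bool; true; false; if_then_else_; _∧_)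
  open import Data.List using (List; []; _∷_; _++_; map; length; filterᵇ)
  open import Data.List.Properties using (filter-++)
  open import Data.List.Relation.Unary.All using (All; []; _∷_)
  open import Data.List.Relation.Unary.All.Properties using (filter⁺)
  open import Relation.Binary.PropositionalEquality

  isPartitionOf : ℕ → List ℕ → Bool
  isPartitionOf n ps = allAllowedᵇ m ps ∧ (sum ps ≡ᵇ n)

  summand : List ℕ → Series
  summand ps n = if isPartitionOf n ps then sgn (length ps) else + 0

  summand-∷ : ∀ x ps → allowedᵇ m x ≡ true → summand (x ∷ ps) ≗ ⊝ x^ x ∙ summand ps
  summand-∷ x ps allowed n rewrite allowed with allAllowedᵇ m ps
  ... | false = sym (cong -_ (x^-𝟘 x n))
  ... | true = begin
    monomial (sgn (suc (length ps))) (x ℕ.+ sum ps) n  ≡⟨ cong (λ σ → monomial σ (x ℕ.+ sum ps) n) (sgn-suc (length ps)) ⟩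
    monomial (- sgn (length ps)) (x ℕ.+ sum ps) n      ≡⟨ ⊝-monomial (sgn (length ps)) (x ℕ.+ sum ps) n ⟨
    - monomial (sgn (length ps)) (x ℕ.+ sum ps) n      ≡⟨ cong -_ (x^-monomial x (sgn (length ps)) (sum ps) n) ⟨
    - (x^ x ∙ monomial (sgn (length ps)) (sum ps)) n ∎
    where open ≡-Reasoning

  signedPartitions : List (List ℕ) → Series
  signedPartitions S n = signedSum (isPartitionOf n) length S

  diff≡signedPartitions : ∀ n → diff m n ≡ signedPartitions (sublists (down n)) n
  diff≡signedPartitions n = evenCount-minus-oddCount (isPartitionOf n) length (sublists (down n))

  signedPartitions-++ : ∀ S S′ → signedPartitions (S ++ S′) ≗ signedPartitions S ⊕ signedPartitions S′
  signedPartitions-++ [] S′ n = sym (ℤ.+-identityˡ _)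
  signedPartitions-++ (ps ∷ S) S′ n =
    trans (cong (λ z → summand ps n + z) (signedPartitions-++ S S′ n))
          (sym (ℤ.+-assoc (summand ps n) (signedPartitions S n) (signedPartitions S′ n)))

  signedPartitions-∷-allowed : ∀ x S → allowedᵇ m x ≡ true →
                                signedPartitions (map (x ∷_) S) ≗ ⊝ x^ x ∙ signedPartitions S
  signedPartitions-∷-allowed x [] _ n = sym (cong -_ (x^-𝟘 x n))
  signedPartitions-∷-allowed x (ps ∷ S) allowed n =
    trans (cong₂ _+_ (summand-∷ x ps allowed n) (signedPartitions-∷-allowed x S allowed n))
          (sym (⊝x^-additive x (summand ps) (signedPartitions S) n))

  signedPartitions-∷-disallowed : ∀ x S → allowedᵇ m x ≡ false → signedPartitions (map (x ∷_) S) ≗ 𝟘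
  signedPartitions-∷-disallowed x [] _ n = refl
  signedPartitions-∷-disallowed x (ps ∷ S) disallowed n rewrite disallowed =
    trans (ℤ.+-identityˡ _) (signedPartitions-∷-disallowed x S disallowed n)

  signedPartitions-sublists : ∀ L → signedPartitions (sublists L) ≗ ∏1-x^ filterᵇ (allowedᵇ m) L ∙ 𝟙
  signedPartitions-sublists [] zero = refl
  signedPartitions-sublists [] (suc n) = refl
  signedPartitions-sublists (x ∷ L) with allowedᵇ m x in allowed
  ... | true = begin
    signedPartitions (map (x ∷_) (sublists L) ++ sublists L)
      ≈⟨ signedPartitions-++ (map (x ∷_) (sublists L)) (sublists L) ⟩
    signedPartitions (map (x ∷_) (sublists L)) ⊕ signedPartitions (sublists L)
      ≈⟨ ⊕-congˡ (signedPartitions (sublists L)) (signedPartitions-∷-allowed x (sublists L) allowed) ⟩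
    ⊝ x^ x ∙ signedPartitions (sublists L) ⊕ signedPartitions (sublists L)
      ≈⟨ ⊕-comm (⊝ x^ x ∙ signedPartitions (sublists L)) (signedPartitions (sublists L)) ⟩
    1-x^ x ∙ signedPartitions (sublists L)
      ≈⟨ 1-x^-cong x (signedPartitions-sublists L) ⟩
    1-x^ x ∙ ∏1-x^ filterᵇ (allowedᵇ m) L ∙ 𝟙 ∎
    where open ≗-Reasoning
  ... | false = begin
    signedPartitions (map (x ∷_) (sublists L) ++ sublists L)
      ≈⟨ signedPartitions-++ (map (x ∷_) (sublists L)) (sublists L) ⟩
    signedPartitions (map (x ∷_) (sublists L)) ⊕ signedPartitions (sublists L)
      ≈⟨ ⊕-congˡ (signedPartitions (sublists L)) (signedPartitions-∷-disallowed x (sublists L) allowed) ⟩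
    𝟘 ⊕ signedPartitions (sublists L)
      ≈⟨ 𝟘⊕ (signedPartitions (sublists L)) ⟩
    signedPartitions (sublists L)
      ≈⟨ signedPartitions-sublists L ⟩
    ∏1-x^ filterᵇ (allowedᵇ m) L ∙ 𝟙 ∎
    where open ≗-Reasoning

  diff≡coefficient : ∀ n → diff m n ≡ (∏1-x^ filterᵇ (allowedᵇ m) (down n) ∙ 𝟙) n
  diff≡coefficient n = trans (diff≡signedPartitions n) (signedPartitions-sublists (down n) n)

  down-+ : ∀ a b → down (a ℕ.+ b) ≡ map (ℕ._+ b) (down a) ++ down b
  down-+ zero b = refl
  down-+ (suc a) b = cong (suc (a ℕ.+ b) ∷_) (down-+ a b)

  down-+-> : ∀ K n → All (suc n ℕ.≤_) (map (ℕ._+ n) (down K))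
  down-+-> zero n = []
  down-+-> (suc K) n = s≤s (ℕ.m≤n+m n K) ∷ down-+-> K n

  ∏1-x^-down-≈ : ∀ K n →
    ∏1-x^ filterᵇ (allowedᵇ m) (down (K ℕ.+ n)) ∙ 𝟙 ≈[ suc n ] ∏1-x^ filterᵇ (allowedᵇ m) (down n) ∙ 𝟙
  ∏1-x^-down-≈ K n i i≤n = begin
    (∏1-x^ allowed (down (K ℕ.+ n)) ∙ 𝟙) i
      ≡⟨ cong (λ L → (∏1-x^ allowed L ∙ 𝟙) i) (down-+ K n) ⟩
    (∏1-x^ allowed (large ++ down n) ∙ 𝟙) i
      ≡⟨ cong (λ L → (∏1-x^ L ∙ 𝟙) i) (filter-++ _ large (down n)) ⟩
    (∏1-x^ allowed large ++ allowed (down n) ∙ 𝟙) i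
      ≡⟨ cong (λ f → f i) (∏1-x^-++ (allowed large) (allowed (down n)) 𝟙) ⟩
    (∏1-x^ allowed large ∙ ∏1-x^ allowed (down n) ∙ 𝟙) i
      ≡⟨ ∏1-x^-high (allowed large) _ (filter⁺ _ (down-+-> K n)) i i≤n ⟩
    (∏1-x^ allowed (down n) ∙ 𝟙) i ∎
    where open ≡-Reasoning
          allowed : List ℕ → List ℕ
          allowed = filterᵇ (allowedᵇ m)
          large : List ℕ
          large = map (ℕ._+ n) (down K)

module AllowedParts (c : ℕ) where

  open import Data.Nat using (zero; suc; _+_; _*_; _%_; _≤_; _<_; s≤s; z≤n)
  open PowerSeries
  open BooleanEquality
  open GaussianBinomial (suc (suc c))
  open TripleProduct (suc (suc c))
  open PartitionGeneratingFunction m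
  import Data.Nat.Properties as ℕ
  open import Data.Nat.DivMod using (m≤n⇒m%n≡m; n%n≡0; [m+kn]%n≡m%n)
  open import Data.Bool using (true; false)
  open import Data.List using (List; []; _∷_; _++_; map; filterᵇ)
  open import Data.List.Properties using (filter-++)
  open import Relation.Binary.PropositionalEquality

  %-+-multiple : ∀ i T → (i + m * T) % m ≡ i % m
  %-+-multiple i T = trans (cong (λ n → (i + n) % m) (ℕ.*-comm m T)) ([m+kn]%n≡m%n i T m)

  allowed-zero : ∀ T → allowedᵇ m (m + m * T) ≡ true
  allowed-zero T rewrite %-+-multiple m T | n%n≡0 m ⦃ _ ⦄ = refl

  allowed-minus-one : ∀ T → allowedᵇ m (suc (suc c) + m * T) ≡ true
  allowed-minus-one T rewrite %-+-multiple (suc (suc c)) T | m≤n⇒m%n≡m (ℕ.≤-refl {suc (suc c)})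
    | ≡ᵇ-refl c = refl

  allowed-one : ∀ T → allowedᵇ m (1 + m * T) ≡ true
  allowed-one T rewrite %-+-multiple 1 T | m≤n⇒m%n≡m {1} {suc (suc c)} (s≤s z≤n) = refl

  disallowed-middle : ∀ T j → j < c → allowedᵇ m (suc (suc j) + m * T) ≡ false
  disallowed-middle T j j<c
    rewrite %-+-multiple (suc (suc j)) T | m≤n⇒m%n≡m {suc (suc j)} {suc (suc c)} (s≤s (s≤s (ℕ.<⇒≤ j<c)))
          | ≢⇒≡ᵇ-false j c (ℕ.<⇒≢ j<c) = refl

  allowed-below : ∀ T j → j ≤ c → filterᵇ (allowedᵇ m) (map (_+ m * T) (down (suc j))) ≡ m * T + 1 ∷ []
  allowed-below T zero _ rewrite allowed-one T = cong (_∷ []) (ℕ.+-comm 1 (m * T))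
  allowed-below T (suc j) j<c rewrite disallowed-middle T j j<c = allowed-below T j (ℕ.<⇒≤ j<c)

  allowed-block : ∀ T →
    filterᵇ (allowedᵇ m) (map (_+ m * T) (down m)) ≡ m * suc T ∷ m * T + suc (suc c) ∷ m * T + 1 ∷ []
  allowed-block T rewrite allowed-zero T | allowed-minus-one T | allowed-below T c ℕ.≤-refl =
    cong₂ _∷_ (sym (ℕ.*-suc m T)) (cong (_∷ m * T + 1 ∷ []) (ℕ.+-comm (suc (suc c)) (m * T)))

  allowed-down-m*suc : ∀ T → filterᵇ (allowedᵇ m) (down (m * suc T))
                            ≡ m * suc T ∷ m * T + suc (suc c) ∷ m * T + 1 ∷ filterᵇ (allowedᵇ m) (down (m * T))
  allowed-down-m*suc T = begin
    allowed (down (m * suc T))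
      ≡⟨ cong (λ n → allowed (down n)) (ℕ.*-suc m T) ⟩
    allowed (down (m + m * T))
      ≡⟨ cong allowed (down-+ m (m * T)) ⟩
    allowed (map (_+ m * T) (down m) ++ down (m * T))
      ≡⟨ filter-++ _ (map (_+ m * T) (down m)) (down (m * T)) ⟩
    allowed (map (_+ m * T) (down m)) ++ allowed (down (m * T))
      ≡⟨ cong (_++ allowed (down (m * T))) (allowed-block T) ⟩
    m * suc T ∷ m * T + suc (suc c) ∷ m * T + 1 ∷ allowed (down (m * T)) ∎
    where open ≡-Reasoning
          allowed : List ℕ → List ℕ
          allowed = filterᵇ (allowedᵇ m)

  ∏1-x^-allowed-down : ∀ T f → ∏1-x^ filterᵇ (allowedᵇ m) (down (m * T)) ∙ f
                              ≗ ∏1-x^ residue₀ T ∙ ∏1-x^ residue₁ T ∙ ∏1-x^ residue₋₁ T ∙ f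
  ∏1-x^-allowed-down zero f rewrite ℕ.*-zeroʳ m = λ _ → refl
  ∏1-x^-allowed-down (suc T) f = begin
    ∏1-x^ filterᵇ (allowedᵇ m) (down (m * suc T)) ∙ f
      ≡⟨ cong (∏1-x^_∙ f) (allowed-down-m*suc T) ⟩
    1-x^ a₀ ∙ 1-x^ a₋₁ ∙ 1-x^ a₁ ∙ ∏1-x^ filterᵇ (allowedᵇ m) (down (m * T)) ∙ f
      ≈⟨ 1-x^-cong a₀ (1-x^-cong a₋₁ (1-x^-cong a₁ (∏1-x^-allowed-down T f))) ⟩
    1-x^ a₀ ∙ 1-x^ a₋₁ ∙ 1-x^ a₁ ∙ ∏1-x^ r₀ ∙ R₁
      ≈⟨ 1-x^-cong a₀ (1-x^-cong a₋₁ (∏1-x^-1-x^ r₀ a₁ R₁)) ⟨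
    1-x^ a₀ ∙ 1-x^ a₋₁ ∙ ∏1-x^ r₀ ∙ 1-x^ a₁ ∙ R₁
      ≈⟨ 1-x^-cong a₀ (∏1-x^-1-x^ r₀ a₋₁ (1-x^ a₁ ∙ R₁)) ⟨
    1-x^ a₀ ∙ ∏1-x^ r₀ ∙ 1-x^ a₋₁ ∙ 1-x^ a₁ ∙ R₁
      ≈⟨ 1-x^-cong a₀ (∏1-x^-cong r₀ (1-x^-comm a₋₁ a₁ R₁)) ⟩
    1-x^ a₀ ∙ ∏1-x^ r₀ ∙ 1-x^ a₁ ∙ 1-x^ a₋₁ ∙ ∏1-x^ r₁ ∙ R₋₁
      ≈⟨ 1-x^-cong a₀ (∏1-x^-cong r₀ (1-x^-cong a₁ (∏1-x^-1-x^ r₁ a₋₁ R₋₁))) ⟨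
    1-x^ a₀ ∙ ∏1-x^ r₀ ∙ 1-x^ a₁ ∙ ∏1-x^ r₁ ∙ 1-x^ a₋₁ ∙ R₋₁ ∎
    where open ≗-Reasoning
          a₀ a₁ a₋₁ : ℕ
          a₀ = m * suc T
          a₁ = m * T + 1
          a₋₁ = m * T + suc (suc c)
          r₀ r₁ : List ℕ
          r₀ = residue₀ T
          r₁ = residue₁ T
          R₋₁ R₁ : Series
          R₋₁ = ∏1-x^ residue₋₁ T ∙ f
          R₁ = ∏1-x^ r₁ ∙ R₋₁

module StrictlyIncreasing (f : ℕ → ℕ) (f-step : ∀ n → f n < f (suc n)) where

  import Data.Nat.Properties as ℕ
  open import Data.Empty using (⊥-elim)
  open import Relation.Binary.Definitions using (tri<; tri≈; tri>)
  open import Relation.Binary.PropositionalEquality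

  mono-< : ∀ {k k′} → k < k′ → f k < f k′
  mono-< {k} {suc k′} (s≤s k≤k′) with ℕ.m≤n⇒m<n∨m≡n k≤k′
  ... | inj₁ k<k′ = ℕ.<-trans (mono-< k<k′) (f-step k′)
  ... | inj₂ refl = f-step k

  mono-≤ : ∀ {k k′} → k ≤ k′ → f k ≤ f k′
  mono-≤ k≤k′ with ℕ.m≤n⇒m<n∨m≡n k≤k′
  ... | inj₁ k<k′ = ℕ.<⇒≤ (mono-< k<k′)
  ... | inj₂ refl = ℕ.≤-refl

  injective : ∀ {k k′} → f k ≡ f k′ → k ≡ k′
  injective {k} {k′} fk≡fk′ with ℕ.<-cmp k k′
  ... | tri< k<k′ _ _ = ⊥-elim (ℕ.<⇒≢ (mono-< k<k′) fk≡fk′)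
  ... | tri≈ _ k≡k′ _ = k≡k′
  ... | tri> _ _ k′<k = ⊥-elim (ℕ.<⇒≢ (mono-< k′<k) (sym fk≡fk′))

module Exponents (c : ℕ) where

  open GaussianBinomial (suc (suc c))
  open TripleProduct (suc (suc c))
  open import Data.Nat using (zero; suc; _+_; _*_; _∸_; _/_; _≤_; _<_; s≤s; z≤n)
  import Data.Nat.Properties as ℕ
  open import Data.Nat.DivMod using (m*n/n≡m)
  open import Data.Nat.Tactic.RingSolver using (solve-∀)
  open import Data.Product using (∃; _,_)
  open import Relation.Binary.PropositionalEquality

  Q′-step : ∀ j → Q′ j < Q′ (suc j)
  Q′-step j = subst (Q′ j <_) (ℕ.+-comm (Q′ j) (m * j + suc (suc c)))
                    (ℕ.m<m+n (Q′ j) (ℕ.≤-trans (s≤s z≤n) (ℕ.m≤n+m (suc (suc c)) (m * j))))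

  module P′-increasing = StrictlyIncreasing P′ P′-step
  module Q′-increasing = StrictlyIncreasing Q′ Q′-step

  ≤-Q′ : ∀ k → k ≤ Q′ k
  ≤-Q′ zero = z≤n
  ≤-Q′ (suc k) = ℕ.+-mono-≤ (ℕ.≤-trans (s≤s z≤n) (ℕ.m≤n+m (suc (suc c)) (m * k))) (≤-Q′ k)

  ≤-e+ˡ : ∀ r b → b ≤ e r b + r
  ≤-e+ˡ r zero = z≤n
  ≤-e+ˡ zero (suc b) = ℕ.≤-trans (≤-Q′ (suc b)) (ℕ.m≤m+n (Q′ (suc b)) 0)
  ≤-e+ˡ (suc r) (suc b) = subst (suc b ≤_) (sym (ℕ.+-suc (e r b) r)) (s≤s (≤-e+ˡ r b))

  Q′≡P′+ : ∀ k → Q′ k ≡ P′ k + suc c * k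
  Q′≡P′+ zero = sym (ℕ.*-zeroʳ (suc c))
  Q′≡P′+ (suc k) rewrite Q′≡P′+ k = lemma c (P′ k) k
    where lemma : ∀ c x k → (3 + c) * k + (2 + c) + (x + suc c * k) ≡ x + suc ((3 + c) * k) + suc c * suc k
          lemma = solve-∀

  P′<Q′ : ∀ k → 1 ≤ k → P′ k < Q′ k
  P′<Q′ (suc k) _ rewrite Q′≡P′+ (suc k) = ℕ.m<m+n (P′ (suc k)) (s≤s z≤n)

  Q′<P′-suc : ∀ k → Q′ k < P′ (suc k)
  Q′<P′-suc k rewrite Q′≡P′+ k = ℕ.+-monoʳ-< (P′ k) (s≤s (ℕ.*-monoˡ-≤ k (ℕ.m≤n+m (suc c) 2)))

  P′≢Q′ : ∀ k j → 1 ≤ j → P′ k ≢ Q′ j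
  P′≢Q′ k j 1≤j P′k≡Q′j with ℕ.≤-total k j
  P′≢Q′ zero j 1≤j P′k≡Q′j | inj₁ _ = ℕ.<⇒≢ (ℕ.<-≤-trans 1≤j (≤-Q′ j)) P′k≡Q′j
  P′≢Q′ (suc k) j 1≤j P′k≡Q′j | inj₁ k<j =
    ℕ.<⇒≢ (ℕ.<-≤-trans (P′<Q′ (suc k) (s≤s z≤n)) (Q′-increasing.mono-≤ k<j)) P′k≡Q′j
  ... | inj₂ j≤k with ℕ.m≤n⇒m<n∨m≡n j≤k
  ...   | inj₁ j<k = ℕ.<⇒≢ (ℕ.<-≤-trans (Q′<P′-suc j) (P′-increasing.mono-≤ j<k)) (sym P′k≡Q′j)
  ...   | inj₂ refl = ℕ.<⇒≢ (P′<Q′ j 1≤j) P′k≡Q′j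

  2*P′-suc : ∀ k → suc k * (2 + m * k) ≡ P′ (suc k) * 2
  2*P′-suc zero = lemma c
    where lemma : ∀ c → 1 * (2 + (3 + c) * 0) ≡ (0 + suc ((3 + c) * 0)) * 2
          lemma = solve-∀
  2*P′-suc (suc k) = begin
    suc (suc k) * (2 + m * suc k)             ≡⟨ lemma c k ⟩
    suc k * (2 + m * k) + suc (m * suc k) * 2 ≡⟨ cong (_+ suc (m * suc k) * 2) (2*P′-suc k) ⟩
    P′ (suc k) * 2 + suc (m * suc k) * 2      ≡⟨ ℕ.*-distribʳ-+ 2 (P′ (suc k)) (suc (m * suc k)) ⟨
    P′ (suc (suc k)) * 2 ∎
    where open ≡-Reasoning
          lemma : ∀ c k → suc (suc k) * (2 + (3 + c) * suc k)
                          ≡ suc k * (2 + (3 + c) * k) + suc ((3 + c) * suc k) * 2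
          lemma = solve-∀

  P≡P′ : ∀ k → P m k ≡ P′ k
  P≡P′ zero = refl
  P≡P′ (suc k) = begin
    suc k * (m * suc k ∸ suc c) / 2    ≡⟨ cong (λ n → suc k * n / 2) m*suc-k∸suc-c ⟩
    suc k * (2 + m * k) / 2            ≡⟨ cong (_/ 2) (2*P′-suc k) ⟩
    P′ (suc k) * 2 / 2                 ≡⟨ m*n/n≡m (P′ (suc k)) 2 ⟩
    P′ (suc k) ∎
    where open ≡-Reasoning
          lemma : ∀ c k → (3 + c) * suc k ≡ suc c + (2 + (3 + c) * k)
          lemma = solve-∀
          m*suc-k∸suc-c : m * suc k ∸ suc c ≡ 2 + m * k
          m*suc-k∸suc-c = trans (cong (_∸ suc c) (lemma c k)) (ℕ.m+n∸m≡n (suc c) (2 + m * k))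

  2*Q′ : ∀ j → j * (m * j + suc c) ≡ Q′ j * 2
  2*Q′ zero = refl
  2*Q′ (suc j) = begin
    suc j * (m * suc j + suc c)                   ≡⟨ lemma c j ⟩
    (m * j + suc (suc c)) * 2 + j * (m * j + suc c) ≡⟨ cong (λ n → (m * j + suc (suc c)) * 2 + n) (2*Q′ j) ⟩
    (m * j + suc (suc c)) * 2 + Q′ j * 2          ≡⟨ ℕ.*-distribʳ-+ 2 (m * j + suc (suc c)) (Q′ j) ⟨
    Q′ (suc j) * 2 ∎
    where open ≡-Reasoning
          lemma : ∀ c j → suc j * ((3 + c) * suc j + suc c)
                          ≡ ((3 + c) * j + (2 + c)) * 2 + j * ((3 + c) * j + suc c)
          lemma = solve-∀

  Q≡Q′ : ∀ j → Q m j ≡ Q′ j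
  Q≡Q′ j = trans (cong (_/ 2) (2*Q′ j)) (m*n/n≡m (Q′ j) 2)

  e-cases : ∀ r T → (∃ λ k → r ≡ T + k × e r T ≡ P′ k) ⊎ (∃ λ j → T ≡ r + suc j × e r T ≡ Q′ (suc j))
  e-cases r T with ℕ.≤-total T r
  ... | inj₁ T≤r = inj₁ (r ∸ T , r≡T+k , trans (cong (λ n → e n T) r≡T+k) (e-above T (r ∸ T)))
    where r≡T+k : r ≡ T + (r ∸ T)
          r≡T+k = sym (ℕ.m+[n∸m]≡n T≤r)
  ... | inj₂ r≤T with ℕ.m≤n⇒m<n∨m≡n r≤T
  ...   | inj₂ refl = inj₁ (0 , sym (ℕ.+-identityʳ r) , trans (cong (λ n → e n r) (sym (ℕ.+-identityʳ r))) (e-above r 0))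
  ...   | inj₁ r<T = inj₂ (j , T≡r+j+1 , trans (cong (e r) T≡r+j+1) (e-below r (suc j)))
    where j : ℕ
          j = T ∸ suc r
          T≡r+j+1 : T ≡ r + suc j
          T≡r+j+1 = trans (sym (ℕ.m+[n∸m]≡n r<T)) (sym (ℕ.+-suc r j))

module Coefficients (c : ℕ) where

  open PowerSeries
  open GaussianBinomial (suc (suc c))
  open TripleProduct (suc (suc c))
  open Exponents c
  open import Data.Nat using (suc; _+_; _*_; _≤_; _<_)
  import Data.Nat.Properties as ℕ
  open import Data.Nat.Tactic.RingSolver using (solve-∀)
  import Data.Integer as ℤ
  import Data.Integer.Properties as ℤ
  open import Relation.Nullary using (yes; no)
  open import Relation.Binary.PropositionalEquality

  e-window : ∀ T n r s → r + s ≡ T + T → n + n < T → e r T ≤ n → n < r × n < s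
  e-window T n r s r+s≡T+T n+n<T e≤n = ℕ.+-cancelˡ-< n n r n+n<n+r , ℕ.+-cancelˡ-< n n s n+n<n+s
    where open ℕ.≤-Reasoning
          n+n<n+r : n + n < n + r
          n+n<n+r = begin-strict
            n + n        <⟨ n+n<T ⟩
            T            ≤⟨ ≤-e+ˡ r T ⟩
            e r T + r    ≤⟨ ℕ.+-monoˡ-≤ r e≤n ⟩
            n + r ∎
          T≤n+s : T ≤ n + s
          T≤n+s = ℕ.+-cancelˡ-≤ T T (n + s) (begin
            T + T        ≡⟨ r+s≡T+T ⟨
            r + s        ≤⟨ ℕ.+-monoˡ-≤ s (ℕ.≤-trans (≤-e+ʳ r T) (ℕ.+-monoˡ-≤ T e≤n)) ⟩
            n + T + s    ≡⟨ lemma n T s ⟩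
            T + (n + s)  ∎)
            where lemma : ∀ n T s → n + T + s ≡ T + (n + s)
                  lemma = solve-∀
          n+n<n+s : n + n < n + s
          n+n<n+s = ℕ.<-≤-trans n+n<T T≤n+s

  term-coefficient : ∀ T n r s → r + s ≡ T + T → n + n < T →
    (∏1-x^ residue₀ T ∙ term T r s) n ≡ monomial (sgn (r + T)) (e r T) n
  term-coefficient T n r s r+s≡T+T n+n<T with n ℕ.<? e r T
  ... | yes n<e = begin
    (∏1-x^ residue₀ T ∙ term T r s) n     ≡⟨ ∏1-x^-⊙x^ (residue₀ T) σ (e r T) (qBinomial r s) n ⟩
    σ ℤ.* (x^ e r T ∙ ∏1-x^ residue₀ T ∙ qBinomial r s) n  ≡⟨ cong (σ ℤ.*_) (x^-below (e r T) _ n n<e) ⟩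
    σ ℤ.* + 0                              ≡⟨ ℤ.*-zeroʳ σ ⟩
    + 0                                    ≡⟨ monomial-off σ (e r T) n (ℕ.>⇒≢ n<e) ⟨
    monomial σ (e r T) n ∎
    where open ≡-Reasoning
          σ : ℤ
          σ = sgn (r + T)
  ... | no n≮e = begin
    (∏1-x^ residue₀ T ∙ term T r s) n                    ≡⟨ ∏1-x^-⊙x^ (residue₀ T) σ (e r T) (qBinomial r s) n ⟩
    (σ ⊙ x^ e r T ∙ ∏1-x^ residue₀ T ∙ qBinomial r s) n  ≡⟨ ⊙-≈ σ (x^-≈ (e r T) ≈𝟙) n (ℕ.n<1+n n) ⟩
    (σ ⊙ x^ e r T ∙ 𝟙) n                                 ≡⟨ ⊙x^-𝟙 σ (e r T) n ⟩
    monomial σ (e r T) n ∎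
    where open ≡-Reasoning
          σ : ℤ
          σ = sgn (r + T)
          <⇒≤m*suc : ∀ {x} → n < x → suc n ≤ m * suc x
          <⇒≤m*suc n<x = ℕ.≤-trans n<x (ℕ.≤-trans (ℕ.n≤1+n _) (ℕ.m≤n*m _ m))
          n<r×n<s : n < r × n < s
          n<r×n<s = e-window T n r s r+s≡T+T n+n<T (ℕ.≮⇒≥ n≮e)
          ≈𝟙 : ∏1-x^ residue₀ T ∙ qBinomial r s ≈[ suc n ] 𝟙
          ≈𝟙 = ∏1-x^-residue₀-qBinomial-≈𝟙 T r s (suc n)
                 (<⇒≤m*suc (proj₁ n<r×n<s)) (<⇒≤m*suc (proj₂ n<r×n<s)) (<⇒≤m*suc (ℕ.≤-trans (ℕ.m≤m+n (suc n) n) n+n<T))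

module Degree (c n : ℕ) where

  open PowerSeries
  open Sign
  open GaussianBinomial (suc (suc c))
  open TripleProduct (suc (suc c))
  open PartitionGeneratingFunction m
  open AllowedParts c
  open Exponents c
  open Coefficients c
  open import Data.Nat using (zero; suc; _+_; _*_; _∸_; _≤_; _<_; s≤s; z≤n)
  import Data.Nat.Properties as ℕ
  open import Data.Nat.Tactic.RingSolver using (solve-∀)
  open import Data.List using (List; filterᵇ)
  open import Relation.Binary.PropositionalEquality

  T : ℕ
  T = suc (n + n)

  n+n<T : n + n < T
  n+n<T = ℕ.n<1+n (n + n)

  n≤T : n ≤ T
  n≤T = ℕ.≤-trans (ℕ.m≤m+n n n) (ℕ.n≤1+n (n + n))

  scaledTerm : ℕ → ℕ → Series
  scaledTerm r s = ∏1-x^ residue₀ T ∙ term T r s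

  diff≡antidiagonal : diff m n ≡ antidiagonal (T + T) scaledTerm n
  diff≡antidiagonal = begin
    diff m n
      ≡⟨ diff≡coefficient n ⟩
    (∏1-x^ allowed (down n) ∙ 𝟙) n
      ≡⟨ ∏1-x^-down-≈ K n n (ℕ.n<1+n n) ⟨
    (∏1-x^ allowed (down (K + n)) ∙ 𝟙) n
      ≡⟨ cong (λ k → (∏1-x^ allowed (down k) ∙ 𝟙) n) K+n≡m*T ⟩
    (∏1-x^ allowed (down (m * T)) ∙ 𝟙) n
      ≡⟨ ∏1-x^-allowed-down T 𝟙 n ⟩
    (∏1-x^ residue₀ T ∙ ∏1-x^ residue₁ T ∙ ∏1-x^ residue₋₁ T ∙ 𝟙) n
      ≡⟨ ∏1-x^-cong (residue₀ T) (finite-triple-product T T) n ⟩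
    (∏1-x^ residue₀ T ∙ antidiagonal (T + T) (term T)) n
      ≡⟨ antidiagonal-additive (∏1-x^ residue₀ T ∙_) (∏1-x^-cong (residue₀ T)) (∏1-x^-⊕ (residue₀ T))
                               (T + T) (term T) n ⟩
    antidiagonal (T + T) scaledTerm n ∎
    where open ≡-Reasoning
          allowed : List ℕ → List ℕ
          allowed = filterᵇ (allowedᵇ m)
          K : ℕ
          K = m * T ∸ n
          K+n≡m*T : K + n ≡ m * T
          K+n≡m*T = ℕ.m∸n+n≡m (ℕ.≤-trans n≤T (ℕ.m≤n*m T m))

  diff-vanishing : (∀ r → e r T ≢ n) → diff m n ≡ + 0
  diff-vanishing e≢n = trans diff≡antidiagonal (antidiagonal-vanishing (T + T) scaledTerm n λ r s r+s≡T+T →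
    trans (term-coefficient T n r s r+s≡T+T n+n<T) (monomial-off (sgn (r + T)) (e r T) n (e≢n r)))

  diff-single : ∀ r₀ s₀ → r₀ + s₀ ≡ T + T → e r₀ T ≡ n → (∀ r → r ≢ r₀ → e r T ≢ n) →
                diff m n ≡ sgn (r₀ + T)
  diff-single r₀ s₀ r₀+s₀≡T+T e≡n e≢n = begin
    diff m n                                              ≡⟨ diff≡antidiagonal ⟩
    antidiagonal (T + T) scaledTerm n
      ≡⟨ antidiagonal-single r₀ s₀ scaledTerm n r₀+s₀≡T+T (λ r s r+s≡T+T r≢r₀ →
           trans (term-coefficient T n r s r+s≡T+T n+n<T) (monomial-off (sgn (r + T)) (e r T) n (e≢n r r≢r₀))) ⟩
    (∏1-x^ residue₀ T ∙ term T r₀ s₀) n                   ≡⟨ term-coefficient T n r₀ s₀ r₀+s₀≡T+T n+n<T ⟩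
    monomial (sgn (r₀ + T)) (e r₀ T) n                    ≡⟨ cong (λ k → monomial (sgn (r₀ + T)) k n) e≡n ⟩
    monomial (sgn (r₀ + T)) n n                           ≡⟨ monomial-at (sgn (r₀ + T)) n ⟩
    sgn (r₀ + T) ∎
    where open ≡-Reasoning

  diff-generic : 1 ≤ n → (∀ k → 1 ≤ k → n ≢ P′ k × n ≢ Q′ k) → diff m n ≡ + 0
  diff-generic 1≤n not-pentagonal = diff-vanishing e≢n
    where
      e≢n : ∀ r → e r T ≢ n
      e≢n r e≡n with e-cases r T
      ... | inj₁ (zero , _ , e≡P′0) = ℕ.<⇒≢ 1≤n (trans (sym e≡P′0) e≡n)
      ... | inj₁ (suc k , _ , e≡P′k) = proj₁ (not-pentagonal (suc k) (s≤s z≤n)) (trans (sym e≡n) e≡P′k)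
      ... | inj₂ (j , _ , e≡Q′j) = proj₂ (not-pentagonal (suc j) (s≤s z≤n)) (trans (sym e≡n) e≡Q′j)

  diff-P′ : ∀ k → n ≡ P′ k → diff m n ≡ sgn k
  diff-P′ k n≡P′k = trans (diff-single (T + k) (T ∸ k) r₀+s₀≡T+T e≡n e≢n) sign
    where
      k≤T : k ≤ T
      k≤T = ℕ.≤-trans (≤-P′ k) (subst (_≤ T) n≡P′k n≤T)
      r₀+s₀≡T+T : T + k + (T ∸ k) ≡ T + T
      r₀+s₀≡T+T = trans (ℕ.+-assoc T k (T ∸ k)) (cong (λ x → T + x) (ℕ.m+[n∸m]≡n k≤T))
      e≡n : e (T + k) T ≡ n
      e≡n = trans (e-above T k) (sym n≡P′k)
      e≢n : ∀ r → r ≢ T + k → e r T ≢ n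
      e≢n r r≢r₀ e≡n with e-cases r T
      ... | inj₁ (k′ , r≡T+k′ , e≡P′k′) =
        r≢r₀ (trans r≡T+k′ (cong (λ x → T + x)
          (P′-increasing.injective (trans (sym e≡P′k′) (trans e≡n n≡P′k)))))
      ... | inj₂ (j , _ , e≡Q′j) = P′≢Q′ k (suc j) (s≤s z≤n) (trans (sym n≡P′k) (trans (sym e≡n) e≡Q′j))
      sign : sgn (T + k + T) ≡ sgn k
      sign = trans (cong sgn (lemma T k)) (sgn-+-double T k)
        where lemma : ∀ T k → T + k + T ≡ T + T + k
              lemma = solve-∀

  diff-Q′ : ∀ k → 1 ≤ k → n ≡ Q′ k → diff m n ≡ sgn k
  diff-Q′ k 1≤k n≡Q′k = trans (diff-single u (T + k) r₀+s₀≡T+T e≡n e≢n) sign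
    where
      u : ℕ
      u = T ∸ k
      k≤T : k ≤ T
      k≤T = ℕ.≤-trans (≤-Q′ k) (subst (_≤ T) n≡Q′k n≤T)
      T≡u+k : T ≡ u + k
      T≡u+k = sym (ℕ.m∸n+n≡m k≤T)
      r₀+s₀≡T+T : u + (T + k) ≡ T + T
      r₀+s₀≡T+T = trans (cong (λ x → u + x) (ℕ.+-comm T k)) (trans (sym (ℕ.+-assoc u k T)) (cong (_+ T) (sym T≡u+k)))
      e≡n : e u T ≡ n
      e≡n = trans (cong (e u) T≡u+k) (trans (e-below u k) (sym n≡Q′k))
      e≢n : ∀ r → r ≢ u → e r T ≢ n
      e≢n r r≢u e≡n with e-cases r T
      ... | inj₁ (k′ , _ , e≡P′k′) = P′≢Q′ k′ k 1≤k (trans (sym e≡P′k′) (trans e≡n n≡Q′k))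
      ... | inj₂ (j , T≡r+j+1 , e≡Q′j) =
        r≢u (ℕ.+-cancelʳ-≡ k r u (trans (cong (λ x → r + x) (sym j+1≡k)) (trans (sym T≡r+j+1) T≡u+k)))
        where j+1≡k : suc j ≡ k
              j+1≡k = Q′-increasing.injective (trans (sym e≡Q′j) (trans e≡n n≡Q′k))
      sign : sgn (u + T) ≡ sgn k
      sign = trans (cong (λ t → sgn (u + t)) T≡u+k) (trans (cong sgn (sym (ℕ.+-assoc u u k))) (sgn-+-double u k))

theorem7 : (m : ℕ) → .{{_ : NonZero m}} → 3 ≤ m → (n : ℕ) → 1 ≤ n →
    ((k : ℕ) → 1 ≤ k → (n ≡ P m k ⊎ n ≡ Q m k) → diff m n ≡ sgn k)
    × (((k : ℕ) → 1 ≤ k → (n ≢ P m k) × (n ≢ Q m k)) → diff m n ≡ + 0)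
theorem7 (suc (suc (suc c))) (s≤s (s≤s (s≤s z≤n))) n 1≤n = pentagonal , generic
  where
    open Exponents c
    open Degree c n

    m : ℕ
    m = suc (suc (suc c))

    pentagonal : (k : ℕ) → 1 ≤ k → (n ≡ P m k ⊎ n ≡ Q m k) → diff m n ≡ sgn k
    pentagonal k _ (inj₁ n≡P) = diff-P′ k (trans n≡P (P≡P′ k))
    pentagonal k 1≤k (inj₂ n≡Q) = diff-Q′ k 1≤k (trans n≡Q (Q≡Q′ k))

    generic : ((k : ℕ) → 1 ≤ k → (n ≢ P m k) × (n ≢ Q m k)) → diff m n ≡ + 0
    generic not-PQ = diff-generic 1≤n λ k 1≤k →
      (λ n≡P′ → proj₁ (not-PQ k 1≤k) (trans n≡P′ (sym (P≡P′ k)))) ,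
      (λ n≡Q′ → proj₂ (not-PQ k 1≤k) (trans n≡Q′ (sym (Q≡Q′ k))))
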